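{- Let $n\ge1$ and let $\mathcal B_n$ be the set of $\Gamma$-diagrams of type $(B_n,n)$ of maximal shape $Q$ whose bottom box $(n,1)$ contains a $+$. Then $\mathcal B_n$ is in bijection with the set of preference functions of length $n$. Consequently, the number of $\Gamma$-diagrams of type $(B_n,n)$ of maximal shape equals twice the number of preference functions of length $n$.
   Context: $W$: Weyl group of type $B_n$, simple reflections $s_1,\dots,s_n$ ($s_is_{i+1}$ of order 3 for $i\le n-2$, $s_{n-1}s_n$ of order 4, others commute), Bruhat order $<$. $Q$: boxes $(r,c)$, $1\le r\le n$ (rows top to bottom), $1\le c\le n-r+1$, labeled $s_{r+c-1}$; order = transitive closure of $(r,c)\lessdot(r,c+1)$, $(r,c)\lessdot(r-1,c)$. An $\oplus$-diagram of shape $Q$ is $D:Q\to\{0,+\}$; for a linear extension $b_1,\dots,b_m$ of $Q$, $s_{i_t}:=s_{b_{m+1-t}}$, $t_t=s_{i_t}$ if $D(b_{m+1-t})=0$ and $1$ otherwise, $v_{(0)}=1$, $v_{(k)}=t_1\cdots t_k$; $D$ is a $\Gamma$-diagram if $v_{(k-1)}<v_{(k-1)}s_{i_k}$ for all $k$. A preference function of length $n$ is a word $p_1\cdots p_n$ of positive integers such that $\{p_1,\dots,p_n\}=\{1,\dots,k\}$ for some $k\le n$. -}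

module Defs where

open import Data.Nat using (ℕ; zero; suc; _≤_; _<_; _≡ᵇ_; _*_)
open import Data.Integer using (ℤ; +_; -_; 0ℤ)
open import Data.Fin using (Fin; toℕ) renaming (zero to fzero; suc to fsuc)
open import Data.Vec using (Vec; []; _∷_; tabulate; lookup; toList; head)
open import Data.List using (List; []; _∷_; _++_; reverse; zip; map; length; allFin)
open import Data.List.Membership.Propositional using (_∈_)
open import Data.List.Relation.Unary.Unique.Propositional using (Unique)
open import Data.Bool using (Bool; true; false; if_then_else_)
open import Data.Product using (Σ; ∃; ∃₂; _×_; _,_)
open import Data.Unit using (⊤; tt)
open import Relation.Binary.PropositionalEquality using (_≡_)
open import Relation.Binary.Construct.Closure.Transitive using (TransClosure)

-- The Weyl group W(B_n) as signed permutations in window notation: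
-- w is stored as the vector [w(1), ..., w(n)] of integers.

W : ℕ → Set
W n = Vec ℤ n

e : (n : ℕ) → W n
e n = tabulate (λ k → + suc (toℕ k))

-- ℕ-indexed (0-based) lookup, 0 outside the range (never used there)
at : {n : ℕ} → Vec ℤ n → ℕ → ℤ
at [] _ = 0ℤ
at (x ∷ xs) zero = x
at (x ∷ xs) (suc j) = at xs j

-- right multiplication w ↦ w s_{i+1}, for the 0-based index i : Fin n.
-- For i+1 < n, s_{i+1} is the transposition (i+1, i+2);
-- s_n is the sign change of the last coordinate.
-- (So s_i s_{i+1} has order 3 for i ≤ n-2, s_{n-1} s_n has order 4.)
sref : {n : ℕ} → Fin n → W n → W n
sref {n} i w = tabulate f
  where
  a = toℕ i
  f : Fin n → ℤ
  f k with suc a ≡ᵇ n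
  ... | true = if toℕ k ≡ᵇ a then - at w (toℕ k) else at w (toℕ k)
  ... | false = if toℕ k ≡ᵇ a then at w (suc a)
                else (if toℕ k ≡ᵇ suc a then at w a else at w (toℕ k))

rmul : {n : ℕ} → W n → List (Fin n) → W n
rmul w [] = w
rmul w (i ∷ is) = rmul (sref i w) is

IsLength : {n : ℕ} → W n → ℕ → Set
IsLength {n} w k =
  (∃ λ (c : List (Fin n)) → length c ≡ k × rmul (e n) c ≡ w)
  × (∀ (c : List (Fin n)) → rmul (e n) c ≡ w → k ≤ length c)

ShorterThan : {n : ℕ} → W n → W n → Set
ShorterThan u w = ∃₂ λ k m → IsLength u k × IsLength w m × k < m

-- One step of the Bruhat order: w = u t with t a reflection
-- (a conjugate  s_{a1}...s_{ar} s_i s_{ar}...s_{a1}  of a simple reflection)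
-- and ℓ(u) < ℓ(w).
BruhatStep : {n : ℕ} → W n → W n → Set
BruhatStep {n} u w =
  (∃₂ λ (a : List (Fin n)) (i : Fin n) → w ≡ rmul u (a ++ (i ∷ reverse a)))
  × ShorterThan u w

_<B_ : {n : ℕ} → W n → W n → Set
_<B_ = TransClosure BruhatStep

-- ⊕-diagrams of the maximal shape Q (staircase): row 1 has n boxes,
-- and rows 2..n form the shape for n-1.  Entry true means '+', false '0'.

Diagram : ℕ → Set
Diagram zero = ⊤
Diagram (suc m) = Vec Bool (suc m) × Diagram m

-- the labels read along the canonical linear extension, backwards:
-- row 1 right to left, then row 2 right to left, ..., row n.
-- Box (r,c) carries s_{r+c-1}, represented by the 0-based index r+c-2.
reading : (n : ℕ) → Diagram n → List (Fin n × Bool)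
reading zero tt = []
reading (suc m) (v , D) =
  reverse (zip (allFin (suc m)) (toList v))
  ++ map (λ { (i , b) → (fsuc i , b) }) (reading m D)

-- the Γ-condition  v_(k-1) < v_(k-1) s_{i_k},  v_(k) = v_(k-1) t_k
gammaOK : {n : ℕ} → W n → List (Fin n × Bool) → Set
gammaOK v [] = ⊤
gammaOK v ((i , b) ∷ rest) =
  (v <B sref i v) × gammaOK (if b then v else sref i v) rest

IsΓ : (n : ℕ) → Diagram n → Set
IsΓ n D = gammaOK (e n) (reading n D)

-- the entry in the bottom box (n,1)  (n = 0 has no boxes: junk value false)
bottom : (n : ℕ) → Diagram n → Bool
bottom zero _ = false
bottom (suc zero) (v , _) = head v
bottom (suc (suc m)) (_ , D) = bottom (suc m) D

InB : (n : ℕ) → Diagram n → Set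
InB n D = IsΓ n D × bottom n D ≡ true

IsPref : (n : ℕ) → Vec ℕ n → Set
IsPref n p = ∃ λ k → k ≤ n
  × (∀ i → 1 ≤ lookup p i × lookup p i ≤ k)
  × (∀ j → 1 ≤ j → j ≤ k → ∃ λ i → lookup p i ≡ j)

SubsetBijection : {A B : Set} → (A → Set) → (B → Set) → Set
SubsetBijection {A} {B} P R = Σ (A → B) λ f →
  (∀ x → P x → R (f x))
  × (∀ x x′ → P x → P x′ → f x ≡ f x′ → x ≡ x′)
  × (∀ y → R y → ∃ λ x → P x × f x ≡ y)

HasCount : {A : Set} → (A → Set) → ℕ → Set
HasCount {A} P k = ∃ λ (xs : List A) → Unique xs
  × (∀ x → (P x → x ∈ xs) × (x ∈ xs → P x))
  × length xs ≡ k

-- The Coxeter length is a type-B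
-- inversion count that changes by ±1 under each s_i, so v < v s_i holds exactly
-- when i is an ascent of v, and the Γ-condition becomes a greedy simulation,
-- evaluated one row of Q at a time.  Each row either fails or freezes the first
-- entry of the remaining window, and whether it succeeds depends only on how
-- its +'s sit among the left-to-right maxima of the window.  Recording this
-- row by row gives a code, and the codes of length n are exactly the recursive
-- decompositions of the preference functions of length n according to where the
-- value 1 occurs; both encodings are invertible.  The bottom box is a free
-- choice (s_n always ascends on the positive entry left there), which doubles
-- the count.
module Submission where

open import Defs
open import Data.Nat using (ℕ; zero; suc; pred; _+_; _*_; _≤_; _<_; z≤n; s≤s; _<ᵇ_; _≤ᵇ_; _≡ᵇ_)
import Data.Nat.Properties as ℕ
open import Data.Nat.Tactic.RingSolver using (solve-∀)
open import Data.Integer using (ℤ; +_; -[1+_]; +[1+_]; -_; ∣_∣)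
open import Data.Integer.Properties using (neg-involutive; ∣-i∣≡∣i∣)
open import Data.Fin using (Fin; toℕ) renaming (zero to fzero; suc to fsuc)
open import Data.Vec as Vec using (Vec; []; _∷_; tabulate; toList; lookup)
open import Data.Vec.Properties using (tabulate-cong; length-toList)
open import Data.Vec.Relation.Unary.All as All using (All; []; _∷_)
open import Data.Vec.Relation.Unary.Any using (Any; here; there)
open import Data.List as List using (List; []; _∷_; _++_; _∷ʳ_; length; reverse; zip; allFin)
open import Data.List.Relation.Unary.All as ListAll using ([]; _∷_)
open import Data.List.Relation.Unary.Any using (here; there)
open import Data.List.Membership.Propositional using (_∈_)
open import Data.List.Relation.Unary.Unique.Propositional using (Unique)
open import Data.List.Relation.Unary.AllPairs using ([]; _∷_)
import Data.List.Relation.Unary.Unique.Propositional.Properties as Unique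
open import Data.List.Membership.DecPropositional ℕ._≟_ using (_∈?_)
import Data.List.Membership.Propositional.Properties as ∈
import Data.List.Relation.Unary.All.Properties as ListAllₚ
import Data.List.Properties as List
open import Data.Bool using (Bool; true; false; if_then_else_; not; T)
open import Data.Product using (_×_; _,_; proj₁; proj₂; Σ; ∃; ∃₂)
open import Data.Sum using (_⊎_; inj₁; inj₂)
open import Data.Maybe as Maybe using (Maybe; just; nothing; _>>=_)
open import Data.Unit using (⊤; tt)
open import Data.Empty using (⊥; ⊥-elim)
open import Relation.Binary.PropositionalEquality
open import Relation.Binary.Construct.Closure.Transitive using ([_]; _∷_)
open import Relation.Binary.Definitions using (tri<; tri≈; tri>)
open import Relation.Nullary using (¬_; Dec; yes; no)
open import Relation.Unary using (Decidable)

-- Signed permutations and the length function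

sref′ : {n : ℕ} → Fin n → Vec ℤ n → Vec ℤ n
sref′ fzero (x ∷ []) = - x ∷ []
sref′ fzero (x ∷ y ∷ zs) = y ∷ x ∷ zs
sref′ (fsuc i) (x ∷ xs) = x ∷ sref′ i xs

tabulate-at : {n : ℕ} (xs : Vec ℤ n) → tabulate (λ k → at xs (toℕ k)) ≡ xs
tabulate-at [] = refl
tabulate-at (x ∷ xs) = cong (x ∷_) (tabulate-at xs)

sref-suc : {m : ℕ} (i : Fin m) (x : ℤ) (xs : Vec ℤ m) → sref (fsuc i) (x ∷ xs) ≡ x ∷ sref i xs
sref-suc {m} i x xs with suc (toℕ i) ≡ᵇ m
... | true = refl
... | false = refl

sref≡sref′ : {n : ℕ} (i : Fin n) (w : Vec ℤ n) → sref i w ≡ sref′ i w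
sref≡sref′ fzero (x ∷ []) = refl
sref≡sref′ fzero (x ∷ y ∷ zs) = cong (λ t → y ∷ x ∷ t) (tabulate-at zs)
sref≡sref′ (fsuc i) (x ∷ xs) = trans (sref-suc i x xs) (cong (x ∷_) (sref≡sref′ i xs))

sref′-involutive : {m : ℕ} (i : Fin m) (w : Vec ℤ m) → sref′ i (sref′ i w) ≡ w
sref′-involutive fzero (x ∷ []) = cong (_∷ []) (neg-involutive x)
sref′-involutive fzero (x ∷ y ∷ zs) = refl
sref′-involutive (fsuc i) (x ∷ xs) = cong (x ∷_) (sref′-involutive i xs)

-- The order 1 ≺ 2 ≺ ⋯ ≺ -2 ≺ -1 on nonzero integers: i < n is an ascent of w
-- (ℓ(w s_i) > ℓ(w)) iff w(i) ≺ w(i+1), and n is one iff w(n) ≺ -w(n).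
infix 4 _≺ᵇ_
_≺ᵇ_ : ℤ → ℤ → Bool
(+ a) ≺ᵇ (+ b) = a <ᵇ b
(+ a) ≺ᵇ -[1+ b ] = true
-[1+ a ] ≺ᵇ (+ b) = false
-[1+ a ] ≺ᵇ -[1+ b ] = b <ᵇ a

<ᵇ-true⇒< : (a b : ℕ) → (a <ᵇ b) ≡ true → a < b
<ᵇ-true⇒< a b p = ℕ.<ᵇ⇒< a b (subst T (sym p) tt)

<⇒<ᵇ-true : {a b : ℕ} → a < b → (a <ᵇ b) ≡ true
<⇒<ᵇ-true {zero} {suc b} p = refl
<⇒<ᵇ-true {suc a} {suc b} (s≤s p) = <⇒<ᵇ-true p

≤⇒<ᵇ-false : {a b : ℕ} → b ≤ a → (a <ᵇ b) ≡ false
≤⇒<ᵇ-false {a} {zero} p = refl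
≤⇒<ᵇ-false {suc a} {suc b} (s≤s p) = ≤⇒<ᵇ-false p

≤ᵇ-true⇒≤ : (a b : ℕ) → (a ≤ᵇ b) ≡ true → a ≤ b
≤ᵇ-true⇒≤ a b p = ℕ.≤ᵇ⇒≤ a b (subst T (sym p) tt)

≤⇒≤ᵇ-true : {a b : ℕ} → a ≤ b → (a ≤ᵇ b) ≡ true
≤⇒≤ᵇ-true {zero} p = refl
≤⇒≤ᵇ-true {suc a} p = <⇒<ᵇ-true p

≤ᵇ-false⇒> : (a b : ℕ) → (a ≤ᵇ b) ≡ false → b < a
≤ᵇ-false⇒> a b p with ℕ.≤-<-connex a b
... | inj₁ a≤b with trans (sym p) (≤⇒≤ᵇ-true a≤b)
...   | ()
≤ᵇ-false⇒> a b p | inj₂ b<a = b<a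

<ᵇ-asym : (a b : ℕ) → (a <ᵇ b) ≡ true → (b <ᵇ a) ≡ false
<ᵇ-asym a b p = ≤⇒<ᵇ-false (ℕ.<⇒≤ (<ᵇ-true⇒< a b p))

<ᵇ-connex : (a b : ℕ) → a ≢ b → (a <ᵇ b) ≡ false → (b <ᵇ a) ≡ true
<ᵇ-connex a b a≢b p with ℕ.<-cmp a b
... | tri< a<b _ _ = ⊥-elim (subst T p (ℕ.<⇒<ᵇ a<b))
... | tri≈ _ a≡b _ = ⊥-elim (a≢b a≡b)
... | tri> _ _ b<a = <⇒<ᵇ-true b<a

≺ᵇ-asym : (x y : ℤ) → (x ≺ᵇ y) ≡ true → (y ≺ᵇ x) ≡ false
≺ᵇ-asym (+ a) (+ b) p = <ᵇ-asym a b p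
≺ᵇ-asym (+ a) -[1+ b ] p = refl
≺ᵇ-asym -[1+ a ] -[1+ b ] p = <ᵇ-asym b a p

≺ᵇ-connex : (x y : ℤ) → x ≢ y → (x ≺ᵇ y) ≡ false → (y ≺ᵇ x) ≡ true
≺ᵇ-connex (+ a) (+ b) x≢y p = <ᵇ-connex a b (λ e → x≢y (cong +_ e)) p
≺ᵇ-connex -[1+ a ] (+ b) x≢y p = refl
≺ᵇ-connex -[1+ a ] -[1+ b ] x≢y p = <ᵇ-connex b a (λ e → x≢y (cong -[1+_] (sym e))) p

≺ᵇ-trans : (x y z : ℤ) → (x ≺ᵇ y) ≡ true → (y ≺ᵇ z) ≡ true → (x ≺ᵇ z) ≡ true
≺ᵇ-trans (+ a) (+ b) (+ c) p q = <⇒<ᵇ-true (ℕ.<-trans (<ᵇ-true⇒< a b p) (<ᵇ-true⇒< b c q))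
≺ᵇ-trans (+ a) (+ b) -[1+ c ] p q = refl
≺ᵇ-trans (+ a) -[1+ b ] -[1+ c ] p q = refl
≺ᵇ-trans -[1+ a ] -[1+ b ] -[1+ c ] p q = <⇒<ᵇ-true (ℕ.<-trans (<ᵇ-true⇒< c b q) (<ᵇ-true⇒< b a p))

NonZero : ℤ → Set
NonZero x = x ≢ + 0

≺ᵇ-neg : (x y : ℤ) → NonZero x → NonZero y → (- y ≺ᵇ x) ≡ (- x ≺ᵇ y)
≺ᵇ-neg (+ zero) y x≢0 y≢0 = ⊥-elim (x≢0 refl)
≺ᵇ-neg x (+ zero) x≢0 y≢0 = ⊥-elim (y≢0 refl)
≺ᵇ-neg (+ suc a) (+ suc b) x≢0 y≢0 = refl
≺ᵇ-neg (+ suc a) -[1+ b ] x≢0 y≢0 = refl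
≺ᵇ-neg -[1+ a ] (+ suc b) x≢0 y≢0 = refl
≺ᵇ-neg -[1+ a ] -[1+ b ] x≢0 y≢0 = refl

bit : Bool → ℕ
bit true = 1
bit false = 0

pairInversions : ℤ → ℤ → ℕ
pairInversions x y = bit (y ≺ᵇ x) + bit (- y ≺ᵇ x)

headInversions : {m : ℕ} → ℤ → Vec ℤ m → ℕ
headInversions x [] = 0
headInversions x (y ∷ ys) = pairInversions x y + headInversions x ys

inversions : {m : ℕ} → Vec ℤ m → ℕ
inversions [] = 0
inversions (x ∷ xs) = headInversions x xs + bit (- x ≺ᵇ x) + inversions xs

isAscent : {n : ℕ} → Fin n → Vec ℤ n → Bool
isAscent fzero (x ∷ []) = x ≺ᵇ - x
isAscent fzero (x ∷ y ∷ _) = x ≺ᵇ y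
isAscent (fsuc i) (x ∷ xs) = isAscent i xs

pairInversions-neg : (x y : ℤ) → pairInversions x (- y) ≡ pairInversions x y
pairInversions-neg x y rewrite neg-involutive y = ℕ.+-comm (bit (- y ≺ᵇ x)) (bit (y ≺ᵇ x))

headInversions-sref′ : {m : ℕ} (x : ℤ) (i : Fin m) (ys : Vec ℤ m) →
  headInversions x (sref′ i ys) ≡ headInversions x ys
headInversions-sref′ x fzero (y ∷ []) = cong (_+ 0) (pairInversions-neg x y)
headInversions-sref′ x fzero (y ∷ z ∷ zs) =
  swap (pairInversions x y) (pairInversions x z) (headInversions x zs)
  where
  swap : ∀ a b c → b + (a + c) ≡ a + (b + c)
  swap = solve-∀
headInversions-sref′ x (fsuc i) (y ∷ ys) = cong (_+_ (pairInversions x y)) (headInversions-sref′ x i ys)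

All-sref′ : {m : ℕ} {P : ℤ → Set} → (∀ y → P y → P (- y)) →
  (i : Fin m) (ys : Vec ℤ m) → All P ys → All P (sref′ i ys)
All-sref′ P-neg fzero (y ∷ []) (py ∷ []) = P-neg y py ∷ []
All-sref′ P-neg fzero (y ∷ z ∷ zs) (py ∷ pz ∷ ps) = pz ∷ py ∷ ps
All-sref′ P-neg (fsuc i) (y ∷ ys) (py ∷ ps) = py ∷ All-sref′ P-neg i ys ps

DistinctAbs : ℤ → ℤ → Set
DistinctAbs x y = ∣ x ∣ ≢ ∣ y ∣

WellSigned : {m : ℕ} → Vec ℤ m → Set
WellSigned [] = ⊤
WellSigned (x ∷ xs) = NonZero x × All (DistinctAbs x) xs × WellSigned xs

Bounded : {m : ℕ} → ℕ → Vec ℤ m → Set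
Bounded n w = All (λ y → ∣ y ∣ ≤ n) w

IsSignedPerm : {n : ℕ} → Vec ℤ n → Set
IsSignedPerm {n} w = WellSigned w × Bounded n w

NonZero-neg : (x : ℤ) → NonZero x → NonZero (- x)
NonZero-neg (+ zero) x≢0 = ⊥-elim (x≢0 refl)
NonZero-neg (+ suc a) x≢0 ()
NonZero-neg -[1+ a ] x≢0 ()

NonZero⇒≢neg : (x : ℤ) → NonZero x → x ≢ - x
NonZero⇒≢neg (+ zero) x≢0 = ⊥-elim (x≢0 refl)
NonZero⇒≢neg (+ suc a) x≢0 ()
NonZero⇒≢neg -[1+ a ] x≢0 ()

WellSigned-sref′ : {m : ℕ} (i : Fin m) (w : Vec ℤ m) → WellSigned w → WellSigned (sref′ i w)
WellSigned-sref′ fzero (x ∷ []) (x≢0 , _ , _) = NonZero-neg x x≢0 , [] , tt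
WellSigned-sref′ fzero (x ∷ y ∷ zs) (x≢0 , x#y ∷ x#zs , y≢0 , y#zs , ws) =
  y≢0 , (λ e → x#y (sym e)) ∷ y#zs , x≢0 , x#zs , ws
WellSigned-sref′ (fsuc i) (x ∷ xs) (x≢0 , x#xs , ws) =
  x≢0 , All-sref′ (λ y x#y e → x#y (trans e (∣-i∣≡∣i∣ y))) i xs x#xs , WellSigned-sref′ i xs ws

IsSignedPerm-sref′ : {n : ℕ} (i : Fin n) (w : Vec ℤ n) → IsSignedPerm w → IsSignedPerm (sref′ i w)
IsSignedPerm-sref′ {n} i w (ws , bd) =
  WellSigned-sref′ i w ws , All-sref′ (λ y p → subst (_≤ n) (sym (∣-i∣≡∣i∣ y)) p) i w bd

inversions-sref′ : {m : ℕ} (i : Fin m) (w : Vec ℤ m) → WellSigned w →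
  (isAscent i w ≡ true → inversions (sref′ i w) ≡ suc (inversions w))
  × (isAscent i w ≡ false → inversions w ≡ suc (inversions (sref′ i w)))
inversions-sref′ fzero (x ∷ []) (x≢0 , _ , _) = up , down
  where
  neg-neg : (- - x ≺ᵇ - x) ≡ (x ≺ᵇ - x)
  neg-neg = cong (_≺ᵇ - x) (neg-involutive x)
  up : (x ≺ᵇ - x) ≡ true → inversions (- x ∷ []) ≡ suc (inversions (x ∷ []))
  up p rewrite neg-neg | p | ≺ᵇ-asym x (- x) p = refl
  down : (x ≺ᵇ - x) ≡ false → inversions (x ∷ []) ≡ suc (inversions (- x ∷ []))
  down p rewrite neg-neg | p | ≺ᵇ-connex x (- x) (NonZero⇒≢neg x x≢0) p = refl
inversions-sref′ fzero (x ∷ y ∷ zs) (x≢0 , x#y ∷ _ , y≢0 , _ , _) = up , down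
  where
  regroup : ∀ a c d e f g → 0 + a + c + e + (d + f + g) ≡ a + d + f + (c + e + g)
  regroup = solve-∀
  rest : 0 + bit (- y ≺ᵇ x) + headInversions x zs + bit (- x ≺ᵇ x)
           + (headInversions y zs + bit (- y ≺ᵇ y) + inversions zs)
       ≡ bit (- y ≺ᵇ x) + headInversions y zs + bit (- y ≺ᵇ y)
           + (headInversions x zs + bit (- x ≺ᵇ x) + inversions zs)
  rest = regroup (bit (- y ≺ᵇ x)) (headInversions x zs) (headInversions y zs)
                 (bit (- x ≺ᵇ x)) (bit (- y ≺ᵇ y)) (inversions zs)
  up : (x ≺ᵇ y) ≡ true → inversions (y ∷ x ∷ zs) ≡ suc (inversions (x ∷ y ∷ zs))
  up p rewrite p | ≺ᵇ-asym x y p | ≺ᵇ-neg y x y≢0 x≢0 = cong suc (sym rest)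
  down : (x ≺ᵇ y) ≡ false → inversions (x ∷ y ∷ zs) ≡ suc (inversions (y ∷ x ∷ zs))
  down p rewrite p | ≺ᵇ-connex x y (λ e → x#y (cong ∣_∣ e)) p | ≺ᵇ-neg y x y≢0 x≢0 = cong suc rest
inversions-sref′ (fsuc i) (x ∷ xs) (_ , _ , ws) = up , down
  where
  shift : ∀ a b c → a + b + suc c ≡ suc (a + b + c)
  shift = solve-∀
  up : isAscent i xs ≡ true → inversions (x ∷ sref′ i xs) ≡ suc (inversions (x ∷ xs))
  up p rewrite headInversions-sref′ x i xs | proj₁ (inversions-sref′ i xs ws) p =
    shift (headInversions x xs) (bit (- x ≺ᵇ x)) (inversions xs)
  down : isAscent i xs ≡ false → inversions (x ∷ xs) ≡ suc (inversions (x ∷ sref′ i xs))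
  down p rewrite headInversions-sref′ x i xs | proj₂ (inversions-sref′ i xs ws) p =
    shift (headInversions x xs) (bit (- x ≺ᵇ x)) (inversions (sref′ i xs))

upFrom : ℕ → (m : ℕ) → Vec ℕ m
upFrom a zero = []
upFrom a (suc m) = a ∷ upFrom (suc a) m

idFrom : ℕ → (m : ℕ) → Vec ℤ m
idFrom a m = Vec.map +[1+_] (upFrom a m)

tabulate≡idFrom : (a m : ℕ) → tabulate {n = m} (λ k → +[1+ a + toℕ k ]) ≡ idFrom a m
tabulate≡idFrom a zero = refl
tabulate≡idFrom a (suc m) = cong₂ _∷_ (cong +[1+_] (ℕ.+-identityʳ a))
  (trans (tabulate-cong (λ k → cong +[1+_] (ℕ.+-suc a (toℕ k)))) (tabulate≡idFrom (suc a) m))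

e≡idFrom : (n : ℕ) → e n ≡ idFrom 0 n
e≡idFrom n = tabulate≡idFrom 0 n

idFrom-above : (a b m : ℕ) → b ≤ a → All (λ y → b < ∣ y ∣) (idFrom a m)
idFrom-above a b zero b≤a = []
idFrom-above a b (suc m) b≤a = s≤s b≤a ∷ idFrom-above (suc a) b m (ℕ.m≤n⇒m≤1+n b≤a)

idFrom-below : (a m : ℕ) → All (λ y → ∣ y ∣ ≤ a + m) (idFrom a m)
idFrom-below a zero = []
idFrom-below a (suc m) rewrite ℕ.+-suc a m = s≤s (ℕ.m≤m+n a m) ∷ idFrom-below (suc a) m

WellSigned-idFrom : (a m : ℕ) → WellSigned (idFrom a m)
WellSigned-idFrom a zero = tt
WellSigned-idFrom a (suc m) =
  (λ ()) , All.map (λ a+1<y e → ℕ.<-irrefl e a+1<y) (idFrom-above (suc a) (suc a) m ℕ.≤-refl) ,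
    WellSigned-idFrom (suc a) m

headInversions-idFrom : (a b m : ℕ) → b ≤ a → headInversions +[1+ b ] (idFrom a m) ≡ 0
headInversions-idFrom a b zero b≤a = refl
headInversions-idFrom a b (suc m) b≤a rewrite ≤⇒<ᵇ-false {suc a} {suc b} (s≤s b≤a) =
  headInversions-idFrom (suc a) b m (ℕ.m≤n⇒m≤1+n b≤a)

inversions-idFrom : (a m : ℕ) → inversions (idFrom a m) ≡ 0
inversions-idFrom a zero = refl
inversions-idFrom a (suc m)
  rewrite headInversions-idFrom (suc a) a m (ℕ.n≤1+n a) | inversions-idFrom (suc a) m = refl

IsSignedPerm-e : (n : ℕ) → IsSignedPerm (e n)
IsSignedPerm-e n rewrite e≡idFrom n = WellSigned-idFrom 0 n , idFrom-below 0 n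

inversions-e : (n : ℕ) → inversions (e n) ≡ 0
inversions-e n rewrite e≡idFrom n = inversions-idFrom 0 n

AllAscent : {m : ℕ} → Vec ℤ m → Set
AllAscent {m} w = (i : Fin m) → isAscent i w ≡ true

AllAscent-tail : {m : ℕ} {x : ℤ} {xs : Vec ℤ m} → AllAscent (x ∷ xs) → AllAscent xs
AllAscent-tail asc i = asc (fsuc i)

IsNonNeg : ℤ → Set
IsNonNeg y = ∃ λ c → y ≡ + c

AllAscent⇒nonNeg : {m : ℕ} (w : Vec ℤ m) → AllAscent w → All IsNonNeg w
AllAscent⇒nonNeg [] asc = []
AllAscent⇒nonNeg (x ∷ []) asc = head (asc fzero) ∷ []
  where
  head : {x : ℤ} → (x ≺ᵇ - x) ≡ true → IsNonNeg x
  head {+ a} _ = a , refl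
AllAscent⇒nonNeg (x ∷ y ∷ ys) asc with AllAscent⇒nonNeg (y ∷ ys) (AllAscent-tail asc)
... | (c , refl) ∷ rest = head (asc fzero) ∷ (c , refl) ∷ rest
  where
  head : {x : ℤ} → (x ≺ᵇ + c) ≡ true → IsNonNeg x
  head {+ a} _ = a , refl

AllAscent⇒head≺ : {m : ℕ} (x : ℤ) (xs : Vec ℤ m) → AllAscent (x ∷ xs) → All (λ z → (x ≺ᵇ z) ≡ true) xs
AllAscent⇒head≺ x [] asc = []
AllAscent⇒head≺ x (y ∷ ys) asc =
  asc fzero ∷ All.map (≺ᵇ-trans x y _ (asc fzero)) (AllAscent⇒head≺ y ys (AllAscent-tail asc))

All-zip : {m : ℕ} {P Q : ℤ → Set} {xs : Vec ℤ m} → All P xs → All Q xs → All (λ x → P x × Q x) xs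
All-zip [] [] = []
All-zip (p ∷ ps) (q ∷ qs) = (p , q) ∷ All-zip ps qs

-- m strictly increasing naturals in (lo, lo + m] are lo + 1, …, lo + m.
AllAscent⇒idFrom : (m lo : ℕ) (w : Vec ℤ m) → AllAscent w →
  All (λ y → lo < ∣ y ∣ × ∣ y ∣ ≤ lo + m) w → w ≡ idFrom lo m
AllAscent⇒idFrom zero lo [] asc bounds = refl
AllAscent⇒idFrom (suc m) lo (x ∷ xs) asc ((lo<x , x≤) ∷ bounds) with AllAscent⇒nonNeg (x ∷ xs) asc
... | (a , refl) ∷ nonNeg = cong₂ _∷_ (cong +_ a≡lo+1) xs≡
  where
  above : All (λ z → (+ a ≺ᵇ z) ≡ true) xs
  above = AllAscent⇒head≺ (+ a) xs asc
  a<∣z∣ : {z : ℤ} → IsNonNeg z → (+ a ≺ᵇ z) ≡ true → a < ∣ z ∣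
  a<∣z∣ (c , refl) = <ᵇ-true⇒< a c
  xs≡ : xs ≡ idFrom (suc lo) m
  xs≡ = AllAscent⇒idFrom m (suc lo) xs (AllAscent-tail asc)
    (All.map (λ { {z} ((nn , a≺z) , (_ , z≤)) →
                   ℕ.≤-trans (s≤s lo<x) (a<∣z∣ nn a≺z) , subst (∣ z ∣ ≤_) (ℕ.+-suc lo m) z≤ })
             (All-zip (All-zip nonNeg above) bounds))
  a≤lo+1 : (k : ℕ) (ys : Vec ℤ k) → a ≤ lo + suc k → ys ≡ idFrom (suc lo) k →
    All (λ z → (+ a ≺ᵇ z) ≡ true) ys → a ≤ suc lo
  a≤lo+1 zero [] a≤ _ _ = subst (a ≤_) (trans (ℕ.+-suc lo 0) (cong suc (ℕ.+-identityʳ lo))) a≤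
  a≤lo+1 (suc k) (_ ∷ _) _ refl (a≺lo+2 ∷ _) = ℕ.≤-pred (<ᵇ-true⇒< a (suc (suc lo)) a≺lo+2)
  a≡lo+1 : a ≡ suc lo
  a≡lo+1 = ℕ.≤-antisym (a≤lo+1 m xs x≤ xs≡ above) lo<x

-- Coxeter length and the Bruhat order at a simple reflection

WellSigned⇒nonZero : {m : ℕ} (w : Vec ℤ m) → WellSigned w → All NonZero w
WellSigned⇒nonZero [] _ = []
WellSigned⇒nonZero (x ∷ xs) (x≢0 , _ , ws) = x≢0 ∷ WellSigned⇒nonZero xs ws

NonZero⇒0<∣∣ : (y : ℤ) → NonZero y → 0 < ∣ y ∣
NonZero⇒0<∣∣ (+ zero) y≢0 = ⊥-elim (y≢0 refl)
NonZero⇒0<∣∣ +[1+ a ] y≢0 = s≤s z≤n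
NonZero⇒0<∣∣ -[1+ a ] y≢0 = s≤s z≤n

AllAscent⇒e : {n : ℕ} (w : Vec ℤ n) → IsSignedPerm w → AllAscent w → w ≡ e n
AllAscent⇒e {n} w (ws , bd) asc = trans
  (AllAscent⇒idFrom n 0 w asc
    (All.map (λ {y} (y≢0 , y≤) → NonZero⇒0<∣∣ y y≢0 , y≤) (All-zip (WellSigned⇒nonZero w ws) bd)))
  (sym (e≡idFrom n))

rmul-++ : {n : ℕ} (w : Vec ℤ n) (c d : List (Fin n)) → rmul w (c ++ d) ≡ rmul (rmul w c) d
rmul-++ w [] d = refl
rmul-++ w (i ∷ c) d = rmul-++ (sref i w) c d

descent⊎allAscent : {m : ℕ} (w : Vec ℤ m) → (Σ (Fin m) λ i → isAscent i w ≡ false) ⊎ AllAscent w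
descent⊎allAscent [] = inj₂ (λ ())
descent⊎allAscent (x ∷ xs) with descent⊎allAscent xs
... | inj₁ (i , desc) = inj₁ (fsuc i , desc)
... | inj₂ asc with isAscent fzero (x ∷ xs) in eq
...   | false = inj₁ (fzero , eq)
...   | true = inj₂ λ { fzero → eq ; (fsuc i) → asc i }

-- Peeling off descents one at a time removes one inversion each.
reducedWord : {n : ℕ} (k : ℕ) (w : Vec ℤ n) → inversions w ≡ k → IsSignedPerm w →
  ∃ λ (c : List (Fin n)) → length c ≡ k × rmul (e n) c ≡ w
reducedWord {n} k w inv≡k sp with descent⊎allAscent w
... | inj₂ asc = [] , trans (sym (trans (cong inversions (AllAscent⇒e w sp asc)) (inversions-e n))) inv≡k
                    , sym (AllAscent⇒e w sp asc)
... | inj₁ (i , desc) with k | proj₂ (inversions-sref′ i w (proj₁ sp)) desc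
...   | zero | inv≡ = ⊥-elim (ℕ.0≢1+n (trans (sym inv≡k) inv≡))
...   | suc k′ | inv≡
  with reducedWord k′ (sref′ i w) (ℕ.suc-injective (trans (sym inv≡) inv≡k)) (IsSignedPerm-sref′ i w sp)
...     | c , len≡ , c·e≡ = c ++ i ∷ [] , len≡′ , c·e≡′
  where
  len≡′ : length (c ++ i ∷ []) ≡ suc k′
  len≡′ = trans (List.length-++ c) (trans (ℕ.+-comm (length c) 1) (cong suc len≡))
  c·e≡′ : rmul (e n) (c ++ i ∷ []) ≡ w
  c·e≡′ = begin
    rmul (e n) (c ++ i ∷ [])  ≡⟨ rmul-++ (e n) c (i ∷ []) ⟩
    sref i (rmul (e n) c)     ≡⟨ cong (sref i) c·e≡ ⟩
    sref i (sref′ i w)        ≡⟨ sref≡sref′ i (sref′ i w) ⟩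
    sref′ i (sref′ i w)       ≡⟨ sref′-involutive i w ⟩
    w                         ∎
    where open ≡-Reasoning

inversions-sref′≤ : {m : ℕ} (i : Fin m) (w : Vec ℤ m) → WellSigned w
  → inversions (sref′ i w) ≤ suc (inversions w)
inversions-sref′≤ i w ws with isAscent i w in eq
... | true = ℕ.≤-reflexive (proj₁ (inversions-sref′ i w ws) eq)
... | false = ℕ.m≤n⇒m≤1+n (ℕ.≤-trans (ℕ.n≤1+n _) (ℕ.≤-reflexive (sym (proj₂ (inversions-sref′ i w ws) eq))))

inversions-rmul≤ : {n : ℕ} (w : Vec ℤ n) (c : List (Fin n)) → WellSigned w →
  inversions (rmul w c) ≤ inversions w + length c
inversions-rmul≤ w [] ws = ℕ.m≤m+n (inversions w) 0
inversions-rmul≤ w (i ∷ c) ws rewrite sref≡sref′ i w = begin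
  inversions (rmul (sref′ i w) c)        ≤⟨ inversions-rmul≤ (sref′ i w) c (WellSigned-sref′ i w ws) ⟩
  inversions (sref′ i w) + length c      ≤⟨ ℕ.+-monoˡ-≤ (length c) (inversions-sref′≤ i w ws) ⟩
  suc (inversions w) + length c          ≡⟨ sym (ℕ.+-suc (inversions w) (length c)) ⟩
  inversions w + suc (length c)          ∎
  where open ℕ.≤-Reasoning

IsLength-inversions : {n : ℕ} (w : Vec ℤ n) → IsSignedPerm w → IsLength w (inversions w)
IsLength-inversions {n} w sp = reducedWord (inversions w) w refl sp , minimal
  where
  minimal : (c : List (Fin n)) → rmul (e n) c ≡ w → inversions w ≤ length c
  minimal c refl = subst (λ t → inversions (rmul (e n) c) ≤ t + length c) (inversions-e n)
    (inversions-rmul≤ (e n) c (proj₁ (IsSignedPerm-e n)))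

IsLength-unique : {n : ℕ} {w : Vec ℤ n} {k m : ℕ} → IsLength w k → IsLength w m → k ≡ m
IsLength-unique ((c , len-c , c≡) , k-min) ((d , len-d , d≡) , m-min) =
  ℕ.≤-antisym (subst (_ ≤_) len-d (k-min d d≡)) (subst (_ ≤_) len-c (m-min c c≡))

<B⇒ShorterThan : {n : ℕ} {v w : Vec ℤ n} → v <B w → ShorterThan v w
<B⇒ShorterThan [ _ , shorter ] = shorter
<B⇒ShorterThan ((_ , (k , m , len-k , len-m , k<m)) ∷ rest) with <B⇒ShorterThan rest
... | k′ , m′ , len-k′ , len-m′ , k′<m′ =
  k , m′ , len-k , len-m′ , ℕ.<-trans k<m (subst (_< m′) (IsLength-unique len-k′ len-m) k′<m′)

IsSignedPerm-sref : {n : ℕ} (i : Fin n) (v : Vec ℤ n) → IsSignedPerm v → IsSignedPerm (sref i v)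
IsSignedPerm-sref i v sp = subst IsSignedPerm (sym (sref≡sref′ i v)) (IsSignedPerm-sref′ i v sp)

ascent⇒<B : {n : ℕ} (i : Fin n) (v : Vec ℤ n) → IsSignedPerm v → isAscent i v ≡ true → v <B sref i v
ascent⇒<B i v sp asc =
  [ ([] , i , refl) , inversions v , inversions (sref i v)
  , IsLength-inversions v sp , IsLength-inversions (sref i v) (IsSignedPerm-sref i v sp) , v<sv ]
  where
  v<sv : inversions v < inversions (sref i v)
  v<sv rewrite sref≡sref′ i v | proj₁ (inversions-sref′ i v (proj₁ sp)) asc = ℕ.≤-refl

<B⇒ascent : {n : ℕ} (i : Fin n) (v : Vec ℤ n) → IsSignedPerm v → v <B sref i v → isAscent i v ≡ true
<B⇒ascent i v sp v<sv with isAscent i v in eq | <B⇒ShorterThan v<sv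
... | true | _ = refl
... | false | k , m , len-k , len-m , k<m = ⊥-elim (ℕ.<-asym k<m (subst₂ _<_ m≡ k≡ sv<v))
  where
  k≡ : inversions v ≡ k
  k≡ = IsLength-unique (IsLength-inversions v sp) len-k
  m≡ : inversions (sref i v) ≡ m
  m≡ = IsLength-unique (IsLength-inversions (sref i v) (IsSignedPerm-sref i v sp)) len-m
  sv<v : inversions (sref i v) < inversions v
  sv<v rewrite sref≡sref′ i v | proj₂ (inversions-sref′ i v (proj₁ sp)) eq = ℕ.≤-refl

-- The Γ-condition as a partial computation

step : {n : ℕ} → Fin n → Bool → Vec ℤ n → Maybe (Vec ℤ n)
step i b v = if isAscent i v then just (if b then v else sref′ i v) else nothing

run : {n : ℕ} → Vec ℤ n → List (Fin n × Bool) → Maybe (Vec ℤ n)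
run v [] = just v
run v ((i , b) ∷ rest) = step i b v >>= λ w → run w rest

Defined : {A : Set} → Maybe A → Set
Defined m = ∃ λ a → m ≡ just a

if-sref≡sref′ : {n : ℕ} (i : Fin n) (b : Bool) (v : Vec ℤ n) →
  (if b then v else sref i v) ≡ (if b then v else sref′ i v)
if-sref≡sref′ i true v = refl
if-sref≡sref′ i false v = sref≡sref′ i v

IsSignedPerm-if : {n : ℕ} (i : Fin n) (b : Bool) (v : Vec ℤ n) → IsSignedPerm v →
  IsSignedPerm (if b then v else sref′ i v)
IsSignedPerm-if i true v sp = sp
IsSignedPerm-if i false v sp = IsSignedPerm-sref′ i v sp

gammaOK⇒run-defined : {n : ℕ} (v : Vec ℤ n) (word : List (Fin n × Bool)) → IsSignedPerm v →
  gammaOK v word → Defined (run v word)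
gammaOK⇒run-defined v [] sp ok = v , refl
gammaOK⇒run-defined v ((i , b) ∷ rest) sp (v<sv , ok) rewrite <B⇒ascent i v sp v<sv =
  gammaOK⇒run-defined _ rest (IsSignedPerm-if i b v sp)
    (subst (λ t → gammaOK t rest) (if-sref≡sref′ i b v) ok)

run-defined⇒gammaOK : {n : ℕ} (v : Vec ℤ n) (word : List (Fin n × Bool)) → IsSignedPerm v →
  Defined (run v word) → gammaOK v word
run-defined⇒gammaOK v [] sp _ = tt
run-defined⇒gammaOK v ((i , b) ∷ rest) sp def with isAscent i v in asc
... | true = ascent⇒<B i v sp asc
           , subst (λ t → gammaOK t rest) (sym (if-sref≡sref′ i b v))
               (run-defined⇒gammaOK _ rest (IsSignedPerm-if i b v sp) def)
run-defined⇒gammaOK v ((i , b) ∷ rest) sp (_ , ()) | false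

IsΓ⇔run-defined : (n : ℕ) (D : Diagram n) → (IsΓ n D → Defined (run (e n) (reading n D)))
                                           × (Defined (run (e n) (reading n D)) → IsΓ n D)
IsΓ⇔run-defined n D = gammaOK⇒run-defined (e n) (reading n D) (IsSignedPerm-e n)
                    , run-defined⇒gammaOK (e n) (reading n D) (IsSignedPerm-e n)

run-++ : {n : ℕ} (v : Vec ℤ n) (xs ys : List (Fin n × Bool))
  → run v (xs ++ ys) ≡ (run v xs >>= λ w → run w ys)
run-++ v [] ys = refl
run-++ v ((i , b) ∷ xs) ys with step i b v
... | nothing = refl
... | just w = run-++ w xs ys

step-suc : {m : ℕ} (i : Fin m) (b : Bool) (x : ℤ) (w : Vec ℤ m) →
  step (fsuc i) b (x ∷ w) ≡ Maybe.map (x ∷_) (step i b w)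
step-suc i b x w with isAscent i w
... | false = refl
... | true with b
...   | true = refl
...   | false = refl

ShiftsIndex : {m : ℕ} → (Fin m × Bool → Fin (suc m) × Bool) → Set
ShiftsIndex F = ∀ p → F p ≡ (fsuc (proj₁ p) , proj₂ p)

run-shift : {m : ℕ} {F : Fin m × Bool → Fin (suc m) × Bool} → ShiftsIndex F →
  (x : ℤ) (w : Vec ℤ m) (word : List (Fin m × Bool)) →
  run (x ∷ w) (List.map F word) ≡ Maybe.map (x ∷_) (run w word)
run-shift shifts x w [] = refl
run-shift shifts x w ((i , b) ∷ word) rewrite shifts (i , b) | step-suc i b x w with step i b w
... | nothing = refl
... | just w′ = run-shift shifts x w′ word

rowLetters : {m : ℕ} → Vec Bool m → List (Fin m × Bool)
rowLetters {m} v = reverse (zip (allFin m) (toList v))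

zip-tabulate-suc : {k m : ℕ} {F : Fin m × Bool → Fin (suc m) × Bool} → ShiftsIndex F →
  (g : Fin k → Fin m) (bs : List Bool) →
  zip (List.tabulate (λ j → fsuc (g j))) bs ≡ List.map F (zip (List.tabulate g) bs)
zip-tabulate-suc {zero} shifts g bs = refl
zip-tabulate-suc {suc k} shifts g [] = refl
zip-tabulate-suc {suc k} shifts g (b ∷ bs) =
  cong₂ _∷_ (sym (shifts (g fzero , b))) (zip-tabulate-suc shifts (λ j → g (fsuc j)) bs)

rowLetters-∷ : {m : ℕ} {F : Fin m × Bool → Fin (suc m) × Bool} → ShiftsIndex F →
  (b : Bool) (bs : Vec Bool m) → rowLetters (b ∷ bs) ≡ List.map F (rowLetters bs) ++ (fzero , b) ∷ []
rowLetters-∷ {m} {F} shifts b bs = begin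
  reverse ((fzero , b) ∷ zip (List.tabulate fsuc) (toList bs))
    ≡⟨ List.unfold-reverse (fzero , b) (zip (List.tabulate fsuc) (toList bs)) ⟩
  reverse (zip (List.tabulate fsuc) (toList bs)) ++ (fzero , b) ∷ []
    ≡⟨ cong (λ t → reverse t ++ (fzero , b) ∷ []) (zip-tabulate-suc shifts (λ j → j) (toList bs)) ⟩
  reverse (List.map F (zip (allFin m) (toList bs))) ++ (fzero , b) ∷ []
    ≡⟨ cong (_++ (fzero , b) ∷ []) (sym (List.reverse-map F (zip (allFin m) (toList bs)))) ⟩
  List.map F (rowLetters bs) ++ (fzero , b) ∷ []  ∎
  where open ≡-Reasoning

runRow : {m : ℕ} → Vec ℤ m → Vec Bool m → Maybe (Vec ℤ m)
runRow w v = run w (rowLetters v)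

shiftLetter : {m : ℕ} → Fin m × Bool → Fin (suc m) × Bool
shiftLetter (i , b) = fsuc i , b

-- The leftmost box of a row is read last, after the rest of the row has
-- acted on positions 2, 3, ….
runRow-∷ : {m : ℕ} (x : ℤ) (xs : Vec ℤ m) (b : Bool) (bs : Vec Bool m) →
  runRow (x ∷ xs) (b ∷ bs) ≡ (Maybe.map (x ∷_) (runRow xs bs) >>= step fzero b)
runRow-∷ x xs b bs = begin
  run (x ∷ xs) (rowLetters (b ∷ bs))
    ≡⟨ cong (run (x ∷ xs)) (rowLetters-∷ {F = shiftLetter} (λ _ → refl) b bs) ⟩
  run (x ∷ xs) (List.map shiftLetter (rowLetters bs) ++ (fzero , b) ∷ [])
    ≡⟨ run-++ (x ∷ xs) (List.map shiftLetter (rowLetters bs)) _ ⟩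
  (run (x ∷ xs) (List.map shiftLetter (rowLetters bs)) >>= λ w → run w ((fzero , b) ∷ []))
    ≡⟨ cong (_>>= λ w → run w ((fzero , b) ∷ [])) (run-shift (λ _ → refl) x xs (rowLetters bs)) ⟩
  (Maybe.map (x ∷_) (runRow xs bs) >>= λ w → run w ((fzero , b) ∷ []))
    ≡⟨ bind-single (runRow xs bs) ⟩
  (Maybe.map (x ∷_) (runRow xs bs) >>= step fzero b)  ∎
  where
  open ≡-Reasoning
  bind-single : (r : Maybe (Vec ℤ _)) →
    (Maybe.map (x ∷_) r >>= λ w → run w ((fzero , b) ∷ [])) ≡ (Maybe.map (x ∷_) r >>= step fzero b)
  bind-single nothing = refl
  bind-single (just w) with step fzero b (x ∷ w)
  ... | nothing = refl
  ... | just _ = refl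

run-reading : {m : ℕ} (w : Vec ℤ (suc m)) (v : Vec Bool (suc m)) (D : Diagram m) →
  run w (reading (suc m) (v , D)) ≡ (runRow w v >>= λ w′ → run w′ (List.map shiftLetter (reading m D)))
run-reading {m} w v D = run-++ w (rowLetters v) _

run-tail : (m : ℕ) (y : ℤ) (t : Vec ℤ m) (D : Diagram m) →
  run (y ∷ t) (List.map shiftLetter (reading m D)) ≡ Maybe.map (y ∷_) (run t (reading m D))
run-tail m y t D = run-shift (λ _ → refl) y t (reading m D)

IsNeg : ℤ → Set
IsNeg x = ∃ λ a → x ≡ -[1+ a ]

IsNeg-≺ᵇ : (x y : ℤ) → IsNeg x → (x ≺ᵇ y) ≡ true → IsNeg y
IsNeg-≺ᵇ x -[1+ c ] (a , refl) _ = c , refl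

step-fzero : {m : ℕ} (b : Bool) (x z : ℤ) (r : Vec ℤ m) (y : ℤ) (t : Vec ℤ (suc m)) →
  step fzero b (x ∷ z ∷ r) ≡ just (y ∷ t) → (x ≺ᵇ z) ≡ true × (t ≡ z ∷ r ⊎ t ≡ x ∷ r)
step-fzero b x z r y t eq with x ≺ᵇ z
step-fzero true x z r y t refl | true = refl , inj₁ refl
step-fzero false x z r y t refl | true = refl , inj₂ refl

runRow-keepsNeg : {m : ℕ} (w : Vec ℤ (suc m)) (v : Vec Bool (suc m)) → Any IsNeg w →
  (y : ℤ) (t : Vec ℤ m) → runRow w v ≡ just (y ∷ t) → Any IsNeg t
runRow-keepsNeg (x ∷ []) (b ∷ []) (here (a , refl)) y t ()
runRow-keepsNeg {suc m} (x ∷ xs) (b ∷ bs) neg y t eq with runRow xs bs in rest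
... | nothing rewrite runRow-∷ x xs b bs | rest with eq
...   | ()
runRow-keepsNeg {suc m} (x ∷ xs) (b ∷ bs) neg y t eq | just (z ∷ r)
  rewrite runRow-∷ x xs b bs | rest with step-fzero b x z r y t eq | neg
... | x≺z , inj₁ refl | here x<0 = here (IsNeg-≺ᵇ x z x<0 x≺z)
... | _ , inj₂ refl | here x<0 = here x<0
... | _ , inj₁ refl | there neg′ = there (runRow-keepsNeg xs bs neg′ z r rest)
... | _ , inj₂ refl | there neg′ = there (runRow-keepsNeg xs bs neg′ z r rest)

run-neg-fails : (m : ℕ) (w : Vec ℤ m) (D : Diagram m) → Any IsNeg w → run w (reading m D) ≡ nothing
run-neg-fails (suc m) w (v , D) neg = trans (run-reading w v D) (after (runRow w v) refl)
  where
  after : (r : Maybe (Vec ℤ (suc m))) → runRow w v ≡ r →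
    (r >>= λ w′ → run w′ (List.map shiftLetter (reading m D))) ≡ nothing
  after nothing _ = refl
  after (just (y ∷ t)) eq =
    trans (run-tail m y t D) (cong (Maybe.map (y ∷_)) (run-neg-fails m t D (runRow-keepsNeg w v neg y t eq)))

-- Running one row on the positive window +[1+ u₁ ], …, +[1+ u_k ]: either it is
-- blocked, or it freezes the first entry (whose value is irrelevant when negative)
-- and leaves positive entries behind.  Runs that leave a negative entry behind
-- also count as blocked, since they fail in a later row (run-neg-fails).
data RowOutcome (k : ℕ) : Set where
  blocked : RowOutcome k
  negHead : Vec ℕ k → RowOutcome k
  posHead : ℕ → Vec ℕ k → RowOutcome k

extendRow : {k : ℕ} → ℕ → Bool → RowOutcome k → RowOutcome (suc k)
extendRow x b blocked = blocked
extendRow x false (negHead t) = negHead (x ∷ t)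
extendRow x true (negHead t) = blocked
extendRow x b (posHead c t) =
  if x <ᵇ c then (if b then posHead x (c ∷ t) else posHead c (x ∷ t)) else blocked

rowOutcome : {k : ℕ} → Vec ℕ (suc k) → Vec Bool (suc k) → RowOutcome k
rowOutcome (x ∷ []) (false ∷ []) = negHead []
rowOutcome (x ∷ []) (true ∷ []) = posHead x []
rowOutcome (x ∷ y ∷ ys) (b ∷ bs) = extendRow x b (rowOutcome (y ∷ ys) bs)

data Realises {k : ℕ} : RowOutcome k → Maybe (Vec ℤ (suc k)) → Set where
  negHead : {t : Vec ℕ k} {a : ℕ} → Realises (negHead t) (just (-[1+ a ] ∷ Vec.map +[1+_] t))
  posHead : {c : ℕ} {t : Vec ℕ k} → Realises (posHead c t) (just (+[1+ c ] ∷ Vec.map +[1+_] t))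
  blocked : Realises blocked nothing
  blocked-neg : {y : ℤ} {t : Vec ℤ k} → Any IsNeg t → Realises blocked (just (y ∷ t))

extendRow-realises : {k : ℕ} (x : ℕ) (b : Bool) (r : RowOutcome k) (res : Maybe (Vec ℤ (suc k))) →
  Realises r res → Realises (extendRow x b r) (Maybe.map (+[1+ x ] ∷_) res >>= step fzero b)
extendRow-realises x false (negHead t) _ negHead = negHead
extendRow-realises x true (negHead t) _ negHead = blocked-neg (here (_ , refl))
extendRow-realises x b (posHead c t) _ posHead with x <ᵇ c
extendRow-realises x true (posHead c t) _ posHead | true = posHead
extendRow-realises x false (posHead c t) _ posHead | true = posHead
extendRow-realises x b (posHead c t) _ posHead | false = blocked
extendRow-realises x b blocked _ blocked = blocked
extendRow-realises x b blocked (just (y ∷ t)) (blocked-neg neg) with +[1+ x ] ≺ᵇ y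
extendRow-realises x true blocked (just (y ∷ t)) (blocked-neg neg) | true = blocked-neg (there neg)
extendRow-realises x false blocked (just (y ∷ t)) (blocked-neg neg) | true = blocked-neg (there neg)
extendRow-realises x b blocked (just (y ∷ t)) (blocked-neg neg) | false = blocked

rowOutcome-realises : {k : ℕ} (u : Vec ℕ (suc k)) (v : Vec Bool (suc k)) →
  Realises (rowOutcome u v) (runRow (Vec.map +[1+_] u) v)
rowOutcome-realises (x ∷ []) (false ∷ []) = negHead
rowOutcome-realises (x ∷ []) (true ∷ []) = posHead
rowOutcome-realises (x ∷ y ∷ ys) (b ∷ bs) =
  subst (Realises (rowOutcome (x ∷ y ∷ ys) (b ∷ bs))) (sym (runRow-∷ +[1+ x ] (Vec.map +[1+_] (y ∷ ys)) b bs))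
    (extendRow-realises x b (rowOutcome (y ∷ ys) bs) _ (rowOutcome-realises (y ∷ ys) bs))

valid : (m : ℕ) → Vec ℕ m → Diagram m → Bool
validAfter : (m : ℕ) → RowOutcome m → Diagram m → Bool
valid zero [] tt = true
valid (suc m) u (v , D) = validAfter m (rowOutcome u v) D
validAfter m blocked D = false
validAfter m (negHead t) D = valid m t D
validAfter m (posHead c t) D = valid m t D

Defined-map⁻ : {A B : Set} (f : A → B) (r : Maybe A) → Defined (Maybe.map f r) → Defined r
Defined-map⁻ f (just a) _ = a , refl

Defined-map⁺ : {A B : Set} (f : A → B) (r : Maybe A) → Defined r → Defined (Maybe.map f r)
Defined-map⁺ f (just a) _ = f a , refl

run-defined⇒valid : (m : ℕ) (u : Vec ℕ m) (D : Diagram m) →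
  Defined (run (Vec.map +[1+_] u) (reading m D)) → valid m u D ≡ true
valid⇒run-defined : (m : ℕ) (u : Vec ℕ m) (D : Diagram m) →
  valid m u D ≡ true → Defined (run (Vec.map +[1+_] u) (reading m D))
run-defined⇒valid zero [] tt _ = refl
run-defined⇒valid (suc m) u (v , D) def =
  after (rowOutcome-realises u v) (subst Defined (run-reading (Vec.map +[1+_] u) v D) def)
  where
  after : {r : RowOutcome m} {res : Maybe (Vec ℤ (suc m))} → Realises r res →
    Defined (res >>= λ w → run w (List.map shiftLetter (reading m D))) → validAfter m r D ≡ true
  after (negHead {t}) def′ =
    run-defined⇒valid m t D (Defined-map⁻ _ _ (subst Defined (run-tail m _ _ D) def′))
  after (posHead {t = t}) def′ =
    run-defined⇒valid m t D (Defined-map⁻ _ _ (subst Defined (run-tail m _ _ D) def′))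
  after (blocked-neg {y} {t} neg) (w , eq) with trans
    (sym (cong (Maybe.map (y ∷_)) (run-neg-fails m t D neg))) (trans (sym (run-tail m y t D)) eq)
  ... | ()
valid⇒run-defined zero [] tt _ = [] , refl
valid⇒run-defined (suc m) u (v , D) ok =
  subst Defined (sym (run-reading (Vec.map +[1+_] u) v D)) (after (rowOutcome-realises u v) ok)
  where
  after : {r : RowOutcome m} {res : Maybe (Vec ℤ (suc m))} → Realises r res →
    validAfter m r D ≡ true → Defined (res >>= λ w → run w (List.map shiftLetter (reading m D)))
  after (negHead {t}) ok′ =
    subst Defined (sym (run-tail m _ _ D)) (Defined-map⁺ _ _ (valid⇒run-defined m t D ok′))
  after (posHead {t = t}) ok′ =
    subst Defined (sym (run-tail m _ _ D)) (Defined-map⁺ _ _ (valid⇒run-defined m t D ok′))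

IsΓ⇒valid : (n : ℕ) (D : Diagram n) → IsΓ n D → valid n (upFrom 0 n) D ≡ true
IsΓ⇒valid n D γ =
  run-defined⇒valid n (upFrom 0 n) D
    (subst (λ w → Defined (run w (reading n D))) (e≡idFrom n) (proj₁ (IsΓ⇔run-defined n D) γ))

valid⇒IsΓ : (n : ℕ) (D : Diagram n) → valid n (upFrom 0 n) D ≡ true → IsΓ n D
valid⇒IsΓ n D ok =
  proj₂ (IsΓ⇔run-defined n D)
    (subst (λ w → Defined (run w (reading n D))) (sym (e≡idFrom n)) (valid⇒run-defined n (upFrom 0 n) D ok))


allFalse : {k : ℕ} → Vec Bool k → Bool
allFalse [] = true
allFalse (true ∷ bs) = false
allFalse (false ∷ bs) = allFalse bs

Within : {k : ℕ} → Vec Bool k → Vec Bool k → Set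
Within [] [] = ⊤
Within (b ∷ bs) (f ∷ fs) = (b ≡ true → f ≡ true) × Within bs fs

records : {k : ℕ} → ℕ → Vec ℕ k → Vec Bool k
records t [] = []
records t (x ∷ xs) = if t ≤ᵇ x then true ∷ records (suc x) xs else false ∷ records t xs

trues : {k : ℕ} → Vec Bool k → ℕ
trues [] = 0
trues (b ∷ bs) = bit b + trues bs

flagsBefore : {k : ℕ} → Vec Bool k → Vec Bool k → ℕ
flagsBefore [] [] = 0
flagsBefore (true ∷ bs) (f ∷ fs) = 0
flagsBefore (false ∷ bs) (f ∷ fs) = bit f + flagsBefore bs fs

extendRow≡negHead : {k : ℕ} (x : ℕ) (b : Bool) (r : RowOutcome k) (t : Vec ℕ (suc k))
  → extendRow x b r ≡ negHead t →
  b ≡ false × ∃ λ t′ → r ≡ negHead t′ × t ≡ x ∷ t′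
extendRow≡negHead x b blocked t ()
extendRow≡negHead x false (negHead t′) .(x ∷ t′) refl = refl , t′ , refl , refl
extendRow≡negHead x true (negHead t′) t ()
extendRow≡negHead x b (posHead c t′) t eq with x <ᵇ c
extendRow≡negHead x true (posHead c t′) t () | true
extendRow≡negHead x false (posHead c t′) t () | true
extendRow≡negHead x b (posHead c t′) t () | false

rowOutcome≡negHead⇒ : {k : ℕ} (u : Vec ℕ (suc k)) (v : Vec Bool (suc k)) (r : Vec ℕ k)
  → rowOutcome u v ≡ negHead r → allFalse v ≡ true × r ≡ Vec.init u
rowOutcome≡negHead⇒ (x ∷ []) (false ∷ []) .[] refl = refl , refl
rowOutcome≡negHead⇒ (x ∷ []) (true ∷ []) r ()
rowOutcome≡negHead⇒ (x ∷ y ∷ ys) (b ∷ bs) r eq with extendRow≡negHead x b (rowOutcome (y ∷ ys) bs) r eq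
... | refl , t′ , rest , refl with rowOutcome≡negHead⇒ (y ∷ ys) bs t′ rest
...   | p , refl = p , refl

allFalse⇒rowOutcome≡negHead : {k : ℕ} (u : Vec ℕ (suc k)) (v : Vec Bool (suc k)) → allFalse v ≡ true
  → rowOutcome u v ≡ negHead (Vec.init u)
allFalse⇒rowOutcome≡negHead (x ∷ []) (false ∷ []) p = refl
allFalse⇒rowOutcome≡negHead (x ∷ y ∷ ys) (false ∷ bs) p rewrite allFalse⇒rowOutcome≡negHead (y ∷ ys) bs p =
  refl

extendRow≡posHead : {k : ℕ} (x : ℕ) (b : Bool) (r : RowOutcome k) (c : ℕ) (t : Vec ℕ (suc k))
  → extendRow x b r ≡ posHead c t →
  ∃ λ c′ → ∃ λ t′ → r ≡ posHead c′ t′ × (x <ᵇ c′) ≡ true ×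
    ((b ≡ true × c ≡ x × t ≡ c′ ∷ t′) ⊎ (b ≡ false × c ≡ c′ × t ≡ x ∷ t′))
extendRow≡posHead x b blocked c t ()
extendRow≡posHead x false (negHead t′) c t ()
extendRow≡posHead x true (negHead t′) c t ()
extendRow≡posHead x b (posHead c′ t′) c t eq with x <ᵇ c′ in lt
extendRow≡posHead x true (posHead c′ t′) .x .(c′ ∷ t′) refl | true =
  c′ , t′ , refl , lt , inj₁ (refl , refl , refl)
extendRow≡posHead x false (posHead c′ t′) .c′ .(x ∷ t′) refl | true =
  c′ , t′ , refl , lt , inj₂ (refl , refl , refl)
extendRow≡posHead x b (posHead c′ t′) c t () | false

rowOutcome≡posHead⇒last : {k : ℕ} (u : Vec ℕ (suc k)) (v : Vec Bool (suc k)) (c : ℕ) (r : Vec ℕ k)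
  → rowOutcome u v ≡ posHead c r → Vec.last v ≡ true
rowOutcome≡posHead⇒last (x ∷ []) (false ∷ []) c r ()
rowOutcome≡posHead⇒last (x ∷ []) (true ∷ []) c r eq = refl
rowOutcome≡posHead⇒last (x ∷ y ∷ ys) (b ∷ b′ ∷ bs) c r eq with extendRow≡posHead x b
  (rowOutcome (y ∷ ys) (b′ ∷ bs)) c r eq
... | c′ , t′ , rest , _ , _ = rowOutcome≡posHead⇒last (y ∷ ys) (b′ ∷ bs) c′ t′ rest

rowOutcome≡posHead⇒within : {k : ℕ} (u : Vec ℕ (suc k)) (v : Vec Bool (suc k)) (c : ℕ) (r : Vec ℕ k)
  → rowOutcome u v ≡ posHead c r →
  (t : ℕ) → t ≤ c → Within v (records t u)
rowOutcome≡posHead⇒within (x ∷ []) (false ∷ []) c r () t le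
rowOutcome≡posHead⇒within (x ∷ []) (true ∷ []) .x .[] refl t le rewrite ≤⇒≤ᵇ-true le = (λ _ → refl) , tt
rowOutcome≡posHead⇒within (x ∷ y ∷ ys) (b ∷ bs) c r eq t le with extendRow≡posHead x b
  (rowOutcome (y ∷ ys) bs) c r eq
... | c′ , t′ , rest , x<c′ , inj₁ (refl , refl , refl) rewrite ≤⇒≤ᵇ-true le =
  (λ _ → refl) , rowOutcome≡posHead⇒within (y ∷ ys) bs c′ t′ rest (suc x) (<ᵇ-true⇒< x c′ x<c′)
... | c′ , t′ , rest , x<c′ , inj₂ (refl , refl , refl) with t ≤ᵇ x
...   | true = (λ ()) , rowOutcome≡posHead⇒within (y ∷ ys) bs c′ t′ rest (suc x) (<ᵇ-true⇒< x c′ x<c′)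
...   | false = (λ ()) , rowOutcome≡posHead⇒within (y ∷ ys) bs c′ t′ rest t le

within⇒rowOutcome≡posHead : {k : ℕ} (u : Vec ℕ (suc k)) (v : Vec Bool (suc k)) (t : ℕ)
  → Within v (records t u) → Vec.last v ≡ true →
  ∃ λ c → ∃ λ r → rowOutcome u v ≡ posHead c r × t ≤ c
within⇒rowOutcome≡posHead (x ∷ []) (true ∷ []) t s refl with t ≤ᵇ x in eq
... | true = x , [] , refl , ≤ᵇ-true⇒≤ t x eq
... | false with proj₁ s refl
...   | ()
within⇒rowOutcome≡posHead (x ∷ y ∷ ys) (b ∷ b′ ∷ bs) t s lst with t ≤ᵇ x in eq
... | true with within⇒rowOutcome≡posHead (y ∷ ys) (b′ ∷ bs) (suc x) (proj₂ s) lst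
...   | c′ , r′ , rest , le rewrite rest | <⇒<ᵇ-true le with b
...     | true = x , c′ ∷ r′ , refl , ≤ᵇ-true⇒≤ t x eq
...     | false = c′ , x ∷ r′ , refl , ℕ.≤-trans (≤ᵇ-true⇒≤ t x eq) (ℕ.<⇒≤ le)
within⇒rowOutcome≡posHead (x ∷ y ∷ ys) (b ∷ b′ ∷ bs) t s lst | false with within⇒rowOutcome≡posHead (y ∷ ys)
  (b′ ∷ bs) t (proj₂ s) lst
...   | c′ , r′ , rest , le rewrite rest | <⇒<ᵇ-true (ℕ.<-≤-trans (≤ᵇ-false⇒> t x eq) le) with b in eb
...     | true with proj₁ s refl
...       | ()
within⇒rowOutcome≡posHead (x ∷ y ∷ ys) (b ∷ b′ ∷ bs) t s lst | false | c′ , r′ , rest , le | false =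
  c′ , x ∷ r′ , refl , le

trues-records-posHead : {k : ℕ} (u : Vec ℕ (suc k)) (v : Vec Bool (suc k)) (c : ℕ) (r : Vec ℕ k)
  → rowOutcome u v ≡ posHead c r →
  suc (trues (records (suc c) r)) ≡ trues v
trues-records-posHead (x ∷ []) (false ∷ []) c r ()
trues-records-posHead (x ∷ []) (true ∷ []) .x .[] refl = refl
trues-records-posHead (x ∷ y ∷ ys) (b ∷ b′ ∷ bs) c r eq with extendRow≡posHead x b
  (rowOutcome (y ∷ ys) (b′ ∷ bs)) c r eq
... | c′ , t′ , rest , x<c′ , inj₁ (refl , refl , refl) rewrite x<c′ =
  cong suc (trues-records-posHead (y ∷ ys) (b′ ∷ bs) c′ t′ rest)
... | c′ , t′ , rest , x<c′ , inj₂ (refl , refl , refl) rewrite ≤⇒<ᵇ-false (ℕ.<⇒≤ (<ᵇ-true⇒< x c′ x<c′)) =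
  trues-records-posHead (y ∷ ys) (b′ ∷ bs) c′ t′ rest

trues-records-posHead-from : {k : ℕ} (u : Vec ℕ (suc k)) (v : Vec Bool (suc k)) (c : ℕ) (r : Vec ℕ k)
  → rowOutcome u v ≡ posHead c r →
  (t : ℕ) → t ≤ c → suc (trues (records t r)) ≡ flagsBefore v (records t u) + trues v
trues-records-posHead-from (x ∷ []) (false ∷ []) c r () t le
trues-records-posHead-from (x ∷ []) (true ∷ []) .x .[] refl t le rewrite ≤⇒≤ᵇ-true le = refl
trues-records-posHead-from (x ∷ y ∷ ys) (b ∷ b′ ∷ bs) c r eq t le with extendRow≡posHead x b
  (rowOutcome (y ∷ ys) (b′ ∷ bs)) c r eq
... | c′ , t′ , rest , x<c′ , inj₁ (refl , refl , refl)
  rewrite ≤⇒≤ᵇ-true le | ≤⇒≤ᵇ-true (ℕ.≤-trans le (ℕ.<⇒≤ (<ᵇ-true⇒< x c′ x<c′))) =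
    cong suc (trues-records-posHead (y ∷ ys) (b′ ∷ bs) c′ t′ rest)
... | c′ , t′ , rest , x<c′ , inj₂ (refl , refl , refl) with t ≤ᵇ x in ex
...   | true = trans (cong suc
  (trues-records-posHead-from (y ∷ ys) (b′ ∷ bs) c′ t′ rest (suc x) (<ᵇ-true⇒< x c′ x<c′)))
    (sym (ℕ.+-assoc 1 (flagsBefore (b′ ∷ bs) (records (suc x) (y ∷ ys))) (trues (b′ ∷ bs))))
...   | false = trues-records-posHead-from (y ∷ ys) (b′ ∷ bs) c′ t′ rest t le

rowOutcome≡posHead-lastOnly : {k : ℕ} (u : Vec ℕ (suc k)) (v : Vec Bool (suc k)) (c : ℕ) (r : Vec ℕ k)
  → rowOutcome u v ≡ posHead c r →
  allFalse (Vec.init v) ≡ true → r ≡ Vec.init u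
rowOutcome≡posHead-lastOnly (x ∷ []) (true ∷ []) .x .[] refl p = refl
rowOutcome≡posHead-lastOnly (x ∷ []) (false ∷ []) c r () p
rowOutcome≡posHead-lastOnly (x ∷ y ∷ ys) (b ∷ b′ ∷ bs) c r eq p with extendRow≡posHead x b
  (rowOutcome (y ∷ ys) (b′ ∷ bs)) c r eq
... | c′ , t′ , rest , x<c′ , inj₁ (refl , refl , refl) with p
...   | ()
rowOutcome≡posHead-lastOnly (x ∷ y ∷ ys) (b ∷ b′ ∷ bs) c r eq p | c′ , t′ , rest , x<c′ , inj₂
  (refl , refl , refl) = cong (x ∷_) (rowOutcome≡posHead-lastOnly (y ∷ ys) (b′ ∷ bs) c′ t′ rest p)

records-init : {k : ℕ} (t : ℕ) (u : Vec ℕ (suc k)) → records t (Vec.init u) ≡ Vec.init (records t u)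
records-init t (x ∷ []) with t ≤ᵇ x
... | true = refl
... | false = refl
records-init t (x ∷ y ∷ ys) with t ≤ᵇ x
... | true = cong (true ∷_) (records-init (suc x) (y ∷ ys))
... | false = cong (false ∷_) (records-init t (y ∷ ys))

trues-init : {k : ℕ} (f : Vec Bool (suc k)) → trues (Vec.init f) + bit (Vec.last f) ≡ trues f
trues-init (b ∷ []) = ℕ.+-comm 0 (bit b) 
trues-init (b ∷ b′ ∷ bs) = trans (ℕ.+-assoc (bit b) _ _) (cong (_+_ (bit b)) (trues-init (b′ ∷ bs)))

truesL : List Bool → ℕ
truesL [] = 0
truesL (b ∷ bs) = bit b + truesL bs

anyTrue : List Bool → Bool
anyTrue [] = false
anyTrue (true ∷ s) = true
anyTrue (false ∷ s) = anyTrue s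

anyFalse : List Bool → Bool
anyFalse [] = false
anyFalse (false ∷ s) = true
anyFalse (true ∷ s) = anyFalse s

flipFirst : List Bool → List Bool
flipFirst [] = []
flipFirst (true ∷ s) = false ∷ s
flipFirst (false ∷ s) = true ∷ flipFirst s

unflipFirst : List Bool → List Bool
unflipFirst [] = []
unflipFirst (false ∷ s) = true ∷ s
unflipFirst (true ∷ s) = false ∷ unflipFirst s

unflipFirst-flipFirst : (s : List Bool) → anyTrue s ≡ true → unflipFirst (flipFirst s) ≡ s
unflipFirst-flipFirst (true ∷ s) p = refl
unflipFirst-flipFirst (false ∷ s) p = cong (false ∷_) (unflipFirst-flipFirst s p)

flipFirst-unflipFirst : (s : List Bool) → anyFalse s ≡ true → flipFirst (unflipFirst s) ≡ s
flipFirst-unflipFirst (false ∷ s) p = refl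
flipFirst-unflipFirst (true ∷ s) p = cong (true ∷_) (flipFirst-unflipFirst s p)

anyFalse-flipFirst : (s : List Bool) → anyTrue s ≡ true → anyFalse (flipFirst s) ≡ true
anyFalse-flipFirst (true ∷ s) p = refl
anyFalse-flipFirst (false ∷ s) p = anyFalse-flipFirst s p

anyTrue-unflipFirst : (s : List Bool) → anyFalse s ≡ true → anyTrue (unflipFirst s) ≡ true
anyTrue-unflipFirst (false ∷ s) p = refl
anyTrue-unflipFirst (true ∷ s) p = anyTrue-unflipFirst s p

length-unflipFirst : (s : List Bool) → length (unflipFirst s) ≡ length s
length-unflipFirst [] = refl
length-unflipFirst (false ∷ s) = refl
length-unflipFirst (true ∷ s) = cong suc (length-unflipFirst s)

length-flipFirst : (s : List Bool) → length (flipFirst s) ≡ length s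
length-flipFirst [] = refl
length-flipFirst (true ∷ s) = refl
length-flipFirst (false ∷ s) = cong suc (length-flipFirst s)

restrict : {k : ℕ} → Vec Bool (suc k) → Vec Bool (suc k) → List Bool
restrict (b ∷ bs) (f ∷ []) = []
restrict (b ∷ bs) (true ∷ f′ ∷ fs) = b ∷ restrict bs (f′ ∷ fs)
restrict (b ∷ bs) (false ∷ f′ ∷ fs) = restrict bs (f′ ∷ fs)

expand : {k : ℕ} → List Bool → Vec Bool (suc k) → Vec Bool (suc k)
expand S (f ∷ []) = true ∷ []
expand S (false ∷ f′ ∷ fs) = false ∷ expand S (f′ ∷ fs)
expand [] (true ∷ f′ ∷ fs) = false ∷ expand [] (f′ ∷ fs)
expand (s ∷ S) (true ∷ f′ ∷ fs) = s ∷ expand S (f′ ∷ fs)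

restrict-expand : {k : ℕ} (S : List Bool) (f : Vec Bool (suc k)) → length S ≡ trues (Vec.init f)
  → restrict (expand S f) f ≡ S
restrict-expand [] (f ∷ []) p = refl
restrict-expand S (false ∷ f′ ∷ fs) p = restrict-expand S (f′ ∷ fs) p
restrict-expand (s ∷ S) (true ∷ f′ ∷ fs) p = cong (s ∷_) (restrict-expand S (f′ ∷ fs) (ℕ.suc-injective p))

expand-restrict : {k : ℕ} (v f : Vec Bool (suc k)) → Within v f → Vec.last v ≡ true
  → expand (restrict v f) f ≡ v
expand-restrict (true ∷ []) (f ∷ []) s p = refl
expand-restrict (b ∷ b′ ∷ bs) (true ∷ f′ ∷ fs) s p =
  cong (b ∷_) (expand-restrict (b′ ∷ bs) (f′ ∷ fs) (proj₂ s) p)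
expand-restrict (false ∷ b′ ∷ bs) (false ∷ f′ ∷ fs) s p =
  cong (false ∷_) (expand-restrict (b′ ∷ bs) (f′ ∷ fs) (proj₂ s) p)
expand-restrict (true ∷ b′ ∷ bs) (false ∷ f′ ∷ fs) s p with proj₁ s refl
... | ()

expand-within : {k : ℕ} (S : List Bool) (f : Vec Bool (suc k)) → Vec.last f ≡ true → Within (expand S f) f
expand-within S (true ∷ []) p = (λ _ → refl) , tt
expand-within S (false ∷ f′ ∷ fs) p = (λ ()) , expand-within S (f′ ∷ fs) p
expand-within [] (true ∷ f′ ∷ fs) p = (λ _ → refl) , expand-within [] (f′ ∷ fs) p
expand-within (s ∷ S) (true ∷ f′ ∷ fs) p = (λ _ → refl) , expand-within S (f′ ∷ fs) p

last-expand : {k : ℕ} (S : List Bool) (f : Vec Bool (suc k)) → Vec.last (expand S f) ≡ true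
last-expand S (f ∷ []) = refl
last-expand S (false ∷ f′ ∷ fs) = last-expand S (f′ ∷ fs)
last-expand [] (true ∷ f′ ∷ fs) = last-expand [] (f′ ∷ fs)
last-expand (s ∷ S) (true ∷ f′ ∷ fs) = last-expand S (f′ ∷ fs)

allFalse-init-expand : {k : ℕ} (S : List Bool) (f : Vec Bool (suc k)) → length S ≡ trues (Vec.init f)
  → anyTrue S ≡ true → allFalse (Vec.init (expand S f)) ≡ false
allFalse-init-expand [] (f ∷ []) p ()
allFalse-init-expand S (false ∷ f′ ∷ fs) p q = allFalse-init-expand S (f′ ∷ fs) p q
allFalse-init-expand (true ∷ S) (true ∷ f′ ∷ fs) p q = refl
allFalse-init-expand (false ∷ S) (true ∷ f′ ∷ fs) p q = allFalse-init-expand S (f′ ∷ fs) (ℕ.suc-injective p) q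

length-restrict : {k : ℕ} (v f : Vec Bool (suc k)) → length (restrict v f) ≡ trues (Vec.init f)
length-restrict (b ∷ []) (f ∷ []) = refl
length-restrict (b ∷ b′ ∷ bs) (true ∷ f′ ∷ fs) = cong suc (length-restrict (b′ ∷ bs) (f′ ∷ fs))
length-restrict (b ∷ b′ ∷ bs) (false ∷ f′ ∷ fs) = length-restrict (b′ ∷ bs) (f′ ∷ fs)

anyTrue-restrict : {k : ℕ} (v f : Vec Bool (suc k)) → Within v f → allFalse (Vec.init v) ≡ false
  → anyTrue (restrict v f) ≡ true
anyTrue-restrict (b ∷ []) (f ∷ []) s ()
anyTrue-restrict (true ∷ b′ ∷ bs) (true ∷ f′ ∷ fs) s p = refl
anyTrue-restrict (false ∷ b′ ∷ bs) (true ∷ f′ ∷ fs) s p = anyTrue-restrict (b′ ∷ bs) (f′ ∷ fs) (proj₂ s) p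
anyTrue-restrict (false ∷ b′ ∷ bs) (false ∷ f′ ∷ fs) s p = anyTrue-restrict (b′ ∷ bs) (f′ ∷ fs) (proj₂ s) p
anyTrue-restrict (true ∷ b′ ∷ bs) (false ∷ f′ ∷ fs) s p with proj₁ s refl
... | ()

trues-restrict : {k : ℕ} (v f : Vec Bool (suc k)) → Within v f → Vec.last v ≡ true
  → suc (truesL (restrict v f)) ≡ trues v
trues-restrict (true ∷ []) (f ∷ []) s p = refl
trues-restrict (b ∷ b′ ∷ bs) (true ∷ f′ ∷ fs) s p =
  trans (sym (ℕ.+-suc (bit b) (truesL (restrict (b′ ∷ bs) (f′ ∷ fs)))))
  (cong (_+_ (bit b)) (trues-restrict (b′ ∷ bs) (f′ ∷ fs) (proj₂ s) p))
trues-restrict (false ∷ b′ ∷ bs) (false ∷ f′ ∷ fs) s p = trues-restrict (b′ ∷ bs) (f′ ∷ fs) (proj₂ s) p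
trues-restrict (true ∷ b′ ∷ bs) (false ∷ f′ ∷ fs) s p with proj₁ s refl
... | ()

truesL-flipFirst-restrict : {k : ℕ} (v f : Vec Bool (suc k)) → Within v f → Vec.last v ≡ true
  → allFalse (Vec.init v) ≡ false →
  suc (suc (truesL (flipFirst (restrict v f)))) ≡ flagsBefore v f + trues v
truesL-flipFirst-restrict (b ∷ []) (f ∷ []) s p ()
truesL-flipFirst-restrict (true ∷ b′ ∷ bs) (true ∷ f′ ∷ fs) s p q =
  cong suc (trues-restrict (b′ ∷ bs) (f′ ∷ fs) (proj₂ s) p)
truesL-flipFirst-restrict (false ∷ b′ ∷ bs) (true ∷ f′ ∷ fs) s p q =
  cong suc (truesL-flipFirst-restrict (b′ ∷ bs) (f′ ∷ fs) (proj₂ s) p q)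
truesL-flipFirst-restrict (false ∷ b′ ∷ bs) (false ∷ f′ ∷ fs) s p q =
  truesL-flipFirst-restrict (b′ ∷ bs) (f′ ∷ fs) (proj₂ s) p q
truesL-flipFirst-restrict (true ∷ b′ ∷ bs) (false ∷ f′ ∷ fs) s p q with proj₁ s refl
... | ()

-- A code records, row by row, how a diagram sits on the records (left-to-right
-- maxima) of its window: a blank row whose window ends in a record
-- (appendFreshOne), a row whose only + is in its last box (appendOne), or any
-- other successful row, with β read off the records before the last one
-- (insertOnes β); a blank row not ending in a record leaves no trace.  Read as
-- preference functions (toPref), the same constructors append a new smallest
-- value 1, append another 1, or insert 1's at the false positions of β.
data Code : Set where
  single : Code
  appendFreshOne : Code → Code
  appendOne : Code → Code
  insertOnes : List Bool → Code → Code

IsCode : ℕ → Code → Set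
IsCode (suc zero) single = ⊤
IsCode (suc (suc b)) (appendFreshOne c) = IsCode (suc b) c
IsCode (suc (suc b)) (appendOne c) = IsCode (suc b) c
IsCode (suc (suc b)) (insertOnes β c) = length β ≡ suc b × anyFalse β ≡ true × IsCode (suc (truesL β)) c
IsCode _ _ = ⊥

IsCode-subst : {a b : ℕ} (c : Code) → a ≡ b → IsCode a c → IsCode b c
IsCode-subst c refl isCode = isCode

IsCode-insertOnes : {L : ℕ} {β : List Bool} {c : Code} → L ≡ suc (length β) → anyFalse β ≡ true →
  IsCode (suc (truesL β)) c → IsCode L (insertOnes β c)
IsCode-insertOnes {β = _ ∷ _} refl anyFalse isCode = refl , anyFalse , isCode

recordCount : {m : ℕ} → Vec ℕ m → ℕ
recordCount u = trues (records 0 u)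

lastOnly : (k : ℕ) → Vec Bool (suc k)
lastOnly zero = true ∷ []
lastOnly (suc k) = false ∷ lastOnly k

-- A row whose outcome is blocked is never encoded (junk value single).
encodeRow : {k : ℕ} → Vec ℕ (suc k) → Vec Bool (suc k) → RowOutcome k → (Vec ℕ k → Code) → Code
encodeRow u v blocked encodeRest = single
encodeRow u v (negHead r) encodeRest =
  if Vec.last (records 0 u) then appendFreshOne (encodeRest r) else encodeRest r
encodeRow u v (posHead c r) encodeRest =
  if allFalse (Vec.init v) then appendOne (encodeRest r)
  else insertOnes (flipFirst (restrict v (records 0 u))) (encodeRest r)

encode : (m : ℕ) → Vec ℕ m → Diagram m → Code
encode zero u D = single
encode (suc zero) u D = single
encode (suc (suc m)) u (v , D) = encodeRow u v (rowOutcome u v) (λ r → encode (suc m) r D)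

remaining : {k : ℕ} → Vec ℕ k → RowOutcome k → Vec ℕ k
remaining u (posHead c r) = r
remaining u (negHead r) = r
remaining u blocked = u

decodeRow : {m : ℕ} → Vec ℕ (suc (suc m)) → Code → ((u′ : Vec ℕ (suc m)) → Code → Diagram (suc m)) →
  Diagram (suc (suc m))
decodeRow {m} u (appendFreshOne c) decodeRest = Vec.replicate _ false , decodeRest (Vec.init u) c
decodeRow {m} u (appendOne c) decodeRest = lastOnly (suc m) , decodeRest (Vec.init u) c
decodeRow {m} u (insertOnes β c) decodeRest = v , decodeRest (remaining (Vec.init u) (rowOutcome u v)) c
  where v = expand (unflipFirst β) (records 0 u)
decodeRow {m} u single decodeRest = Vec.replicate _ false , decodeRest (Vec.init u) single

decode : (m : ℕ) → Vec ℕ m → Code → Diagram m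
decode zero u c = tt
decode (suc zero) u c = true ∷ [] , tt
decode (suc (suc m)) u c =
  if Vec.last (records 0 u) then decodeRow u c (decode (suc m))
  else (Vec.replicate _ false , decode (suc m) (Vec.init u) c)

allFalse-replicate : (k : ℕ) → allFalse (Vec.replicate k false) ≡ true
allFalse-replicate zero = refl
allFalse-replicate (suc k) = allFalse-replicate k

allFalse⇒replicate : {k : ℕ} (v : Vec Bool k) → allFalse v ≡ true → v ≡ Vec.replicate k false
allFalse⇒replicate [] _ = refl
allFalse⇒replicate (false ∷ v) p = cong (false ∷_) (allFalse⇒replicate v p)

allFalse-init-lastOnly : (k : ℕ) → allFalse (Vec.init (lastOnly k)) ≡ true
allFalse-init-lastOnly zero = refl
allFalse-init-lastOnly (suc k) = allFalse-init-lastOnly k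

last-lastOnly : (k : ℕ) → Vec.last (lastOnly k) ≡ true
last-lastOnly zero = refl
last-lastOnly (suc k) = last-lastOnly k

lastOnly-within : {k : ℕ} (f : Vec Bool (suc k)) → Vec.last f ≡ true → Within (lastOnly k) f
lastOnly-within (true ∷ []) _ = (λ _ → refl) , tt
lastOnly-within (f ∷ f′ ∷ fs) p = (λ ()) , lastOnly-within (f′ ∷ fs) p

lastOnly-unique : {k : ℕ} (v : Vec Bool (suc k)) → allFalse (Vec.init v) ≡ true → Vec.last v ≡ true
  → v ≡ lastOnly k
lastOnly-unique (true ∷ []) _ _ = refl
lastOnly-unique (false ∷ b ∷ bs) p q = cong (false ∷_) (lastOnly-unique (b ∷ bs) p q)

within-last : {k : ℕ} (v f : Vec Bool (suc k)) → Within v f → Vec.last v ≡ true → Vec.last f ≡ true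
within-last (b ∷ []) (f ∷ []) s p = proj₁ s p
within-last (b ∷ b′ ∷ bs) (f ∷ f′ ∷ fs) s p = within-last (b′ ∷ bs) (f′ ∷ fs) (proj₂ s) p

recordCount-init : {k : ℕ} (u : Vec ℕ (suc k))
  → recordCount (Vec.init u) + bit (Vec.last (records 0 u)) ≡ recordCount u
recordCount-init u = trans (cong (λ z → trues z + bit (Vec.last (records 0 u))) (records-init 0 u))
  (trues-init (records 0 u))

recordCount-nonempty : {k : ℕ} (u : Vec ℕ (suc k)) → ∃ λ j → recordCount u ≡ suc j
recordCount-nonempty (x ∷ xs) = trues (records (suc x) xs) , refl

recordCount-init-true : {k : ℕ} (u : Vec ℕ (suc k)) → Vec.last (records 0 u) ≡ true
  → recordCount u ≡ suc (recordCount (Vec.init u))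
recordCount-init-true u p =
  trans (sym (recordCount-init u))
    (trans (cong (λ z → recordCount (Vec.init u) + bit z) p) (ℕ.+-comm (recordCount (Vec.init u)) 1))

recordCount-init-false : {k : ℕ} (u : Vec ℕ (suc k)) → Vec.last (records 0 u) ≡ false
  → recordCount u ≡ recordCount (Vec.init u)
recordCount-init-false u p =
  trans (sym (recordCount-init u))
    (trans (cong (λ z → recordCount (Vec.init u) + bit z) p) (ℕ.+-identityʳ (recordCount (Vec.init u))))

-- With a record at the end, at least two records: the extra one and the first entry.
recordCount-init-true′ : {k : ℕ} (u : Vec ℕ (suc (suc k))) → Vec.last (records 0 u) ≡ true →
  ∃ λ j → recordCount (Vec.init u) ≡ suc j × recordCount u ≡ suc (suc j)
recordCount-init-true′ u p with recordCount-nonempty (Vec.init u)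
... | j , eq = j , eq , trans (recordCount-init-true u p) (cong suc eq)

posHead⇒lastRecord : {k : ℕ} (u : Vec ℕ (suc k)) (v : Vec Bool (suc k)) (c : ℕ) (r : Vec ℕ k) →
  rowOutcome u v ≡ posHead c r → Vec.last (records 0 u) ≡ true
posHead⇒lastRecord u v c r outcome =
  within-last v (records 0 u) (rowOutcome≡posHead⇒within u v c r outcome 0 z≤n)
    (rowOutcome≡posHead⇒last u v c r outcome)

Encodable : (m : ℕ) → Vec ℕ m → Diagram m → Set
Encodable m u D = IsCode (recordCount u) (encode m u D) × decode m u (encode m u D) ≡ D

encodable-negRow : (m : ℕ) (u : Vec ℕ (suc (suc m))) (v : Vec Bool (suc (suc m))) (D : Diagram (suc m)) →
  rowOutcome u v ≡ negHead (Vec.init u) → allFalse v ≡ true →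
  Encodable (suc m) (Vec.init u) D → Encodable (suc (suc m)) u (v , D)
encodable-negRow m u v D outcome blank (isCode , decodes)
  rewrite outcome with Vec.last (records 0 u) in lastRecord
... | true with recordCount-init-true′ u lastRecord
...   | j , count-init , count = IsCode-subst _ (sym count) (IsCode-subst _ count-init isCode)
                               , cong₂ _,_ (sym (allFalse⇒replicate v blank)) decodes
encodable-negRow m u v D outcome blank (isCode , decodes) | false =
  IsCode-subst _ (sym (recordCount-init-false u lastRecord)) isCode
  , cong₂ _,_ (sym (allFalse⇒replicate v blank)) decodes

encodable-posRow-lastOnly : (m : ℕ) (u : Vec ℕ (suc (suc m))) (v : Vec Bool (suc (suc m)))
  (D : Diagram (suc m)) (c : ℕ) →
  rowOutcome u v ≡ posHead c (Vec.init u) → Vec.last (records 0 u) ≡ true →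
  allFalse (Vec.init v) ≡ true → Vec.last v ≡ true →
  Encodable (suc m) (Vec.init u) D → Encodable (suc (suc m)) u (v , D)
encodable-posRow-lastOnly m u v D c outcome lastRecord lone last (isCode , decodes)
  rewrite outcome | lastRecord | lone with recordCount-init-true′ u lastRecord
... | j , count-init , count = IsCode-subst _ (sym count) (IsCode-subst _ count-init isCode)
                             , cong₂ _,_ (sym (lastOnly-unique v lone last)) decodes

encodable-posRow-insertOnes : (m : ℕ) (u : Vec ℕ (suc (suc m))) (v : Vec Bool (suc (suc m)))
  (D : Diagram (suc m)) (c : ℕ) (r : Vec ℕ (suc m)) →
  rowOutcome u v ≡ posHead c r → Vec.last (records 0 u) ≡ true →
  allFalse (Vec.init v) ≡ false → Encodable (suc m) r D → Encodable (suc (suc m)) u (v , D)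
encodable-posRow-insertOnes m u v D c r outcome lastRecord notLone (isCode , decodes)
  rewrite outcome | lastRecord | notLone = isCode′ , decodes′
  where
  f = records 0 u
  β = flipFirst (restrict v f)
  within : Within v f
  within = rowOutcome≡posHead⇒within u v c r outcome 0 z≤n
  last : Vec.last v ≡ true
  last = rowOutcome≡posHead⇒last u v c r outcome
  anyTrue-β : anyTrue (restrict v f) ≡ true
  anyTrue-β = anyTrue-restrict v f within notLone
  count : recordCount u ≡ suc (length β)
  count = trans (recordCount-init-true u lastRecord)
    (cong suc (trans (cong trues (records-init 0 u))
      (sym (trans (length-flipFirst (restrict v f)) (length-restrict v f)))))
  count-r : recordCount r ≡ suc (truesL β)
  count-r = ℕ.suc-injective
    (trans (trues-records-posHead-from u v c r outcome 0 z≤n)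
      (sym (truesL-flipFirst-restrict v f within last notLone)))
  isCode′ : IsCode (recordCount u) (insertOnes β (encode (suc m) r D))
  isCode′ = IsCode-insertOnes count (anyFalse-flipFirst (restrict v f) anyTrue-β)
    (IsCode-subst _ count-r isCode)
  v≡ : expand (unflipFirst β) f ≡ v
  v≡ = trans (cong (λ z → expand z f) (unflipFirst-flipFirst (restrict v f) anyTrue-β))
    (expand-restrict v f within last)
  decodes′ : decodeRow u (insertOnes β (encode (suc m) r D)) (decode (suc m)) ≡ (v , D)
  decodes′ rewrite v≡ | outcome = cong (v ,_) decodes

encodable-posRow : (m : ℕ) (u : Vec ℕ (suc (suc m))) (v : Vec Bool (suc (suc m))) (D : Diagram (suc m))
  (c : ℕ) (r : Vec ℕ (suc m)) → rowOutcome u v ≡ posHead c r → Encodable (suc m) r D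
    → Encodable (suc (suc m)) u (v , D)
encodable-posRow m u v D c r outcome enc-r with allFalse (Vec.init v) in lone
... | false = encodable-posRow-insertOnes m u v D c r outcome (posHead⇒lastRecord u v c r outcome) lone enc-r
... | true with rowOutcome≡posHead-lastOnly u v c r outcome lone
...   | refl = encodable-posRow-lastOnly m u v D c outcome (posHead⇒lastRecord u v c r outcome) lone
                 (rowOutcome≡posHead⇒last u v c r outcome) enc-r

valid⇒encodable : (m : ℕ) (u : Vec ℕ (suc m)) (D : Diagram (suc m)) →
  valid (suc m) u D ≡ true → bottom (suc m) D ≡ true → Encodable (suc m) u D
valid⇒encodable zero (x ∷ []) ((true ∷ []) , tt) _ _ = tt , refl
valid⇒encodable (suc m) u (v , D) ok bot = byOutcome (rowOutcome u v) refl ok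
  where
  byOutcome : (R : RowOutcome (suc m)) → rowOutcome u v ≡ R → validAfter (suc m) R D ≡ true →
    Encodable (suc (suc m)) u (v , D)
  byOutcome (negHead r) outcome ok′ with rowOutcome≡negHead⇒ u v r outcome
  ... | blank , refl = encodable-negRow m u v D outcome blank (valid⇒encodable m r D ok′ bot)
  byOutcome (posHead c r) outcome ok′ = encodable-posRow m u v D c r outcome (valid⇒encodable m r D ok′ bot)

Decodable : (m : ℕ) → Vec ℕ m → Code → Set
Decodable m u c =
  valid m u (decode m u c) ≡ true × bottom m (decode m u c) ≡ true × encode m u (decode m u c) ≡ c

blankRow-outcome : {m : ℕ} (u : Vec ℕ (suc (suc m)))
  → rowOutcome u (Vec.replicate _ false) ≡ negHead (Vec.init u)
blankRow-outcome {m} u = allFalse⇒rowOutcome≡negHead u _ (allFalse-replicate (suc (suc m)))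

decodable-lastNotRecord : (m : ℕ) (u : Vec ℕ (suc (suc m))) (c : Code) → Vec.last (records 0 u) ≡ false →
  Decodable (suc m) (Vec.init u) c → Decodable (suc (suc m)) u c
decodable-lastNotRecord m u c lastRecord rest rewrite lastRecord | blankRow-outcome u | lastRecord = rest

decodable-appendFreshOne : (m : ℕ) (u : Vec ℕ (suc (suc m))) (c : Code) → Vec.last (records 0 u) ≡ true →
  Decodable (suc m) (Vec.init u) c → Decodable (suc (suc m)) u (appendFreshOne c)
decodable-appendFreshOne m u c lastRecord (ok , bot , enc)
  rewrite lastRecord | blankRow-outcome u | lastRecord = ok , bot , cong appendFreshOne enc

decodable-appendOne : (m : ℕ) (u : Vec ℕ (suc (suc m))) (c : Code) → Vec.last (records 0 u) ≡ true →
  Decodable (suc m) (Vec.init u) c → Decodable (suc (suc m)) u (appendOne c)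
decodable-appendOne m u c lastRecord (ok , bot , enc) = go posOutcome
  where
  posOutcome = within⇒rowOutcome≡posHead u (lastOnly (suc m)) 0 (lastOnly-within (records 0 u) lastRecord)
    (last-lastOnly (suc m))
  go : (∃ λ c₀ → ∃ λ r → rowOutcome u (lastOnly (suc m)) ≡ posHead c₀ r × 0 ≤ c₀)
    → Decodable (suc (suc m)) u (appendOne c)
  go (c₀ , r , outcome , _) with rowOutcome≡posHead-lastOnly u _ c₀ r outcome (allFalse-init-lastOnly (suc m))
  ... | refl rewrite lastRecord | outcome | allFalse-init-lastOnly (suc m) = ok , bot , cong appendOne enc

decodable-insertOnes : (m : ℕ) (u : Vec ℕ (suc (suc m))) (β : List Bool) (c : Code)
  → Vec.last (records 0 u) ≡ true →
  length β ≡ trues (Vec.init (records 0 u)) → anyFalse β ≡ true →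
  ((r : Vec ℕ (suc m)) → recordCount r ≡ suc (truesL β) → Decodable (suc m) r c) →
  Decodable (suc (suc m)) u (insertOnes β c)
decodable-insertOnes m u β c lastRecord length-β anyFalse-β rest =
  go (within⇒rowOutcome≡posHead u v 0 within last)
  where
  f = records 0 u
  v = expand (unflipFirst β) f
  length-unflip : length (unflipFirst β) ≡ trues (Vec.init f)
  length-unflip = trans (length-unflipFirst β) length-β
  within : Within v f
  within = expand-within (unflipFirst β) f lastRecord
  last : Vec.last v ≡ true
  last = last-expand (unflipFirst β) f
  notLone : allFalse (Vec.init v) ≡ false
  notLone = allFalse-init-expand (unflipFirst β) f length-unflip (anyTrue-unflipFirst β anyFalse-β)
  β≡ : flipFirst (restrict v f) ≡ β
  β≡ = trans (cong flipFirst (restrict-expand (unflipFirst β) f length-unflip))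
    (flipFirst-unflipFirst β anyFalse-β)
  go : (∃ λ c₀ → ∃ λ r → rowOutcome u v ≡ posHead c₀ r × 0 ≤ c₀) → Decodable (suc (suc m)) u (insertOnes β c)
  go (c₀ , r , outcome , _) rewrite lastRecord | outcome | notLone with rest r count-r
    where
    count-r : recordCount r ≡ suc (truesL β)
    count-r = ℕ.suc-injective (trans (trues-records-posHead-from u v c₀ r outcome 0 z≤n)
      (trans (sym (truesL-flipFirst-restrict v f within last notLone))
        (cong (λ z → suc (suc (truesL z))) β≡)))
  ... | ok , bot , enc = ok , bot , cong₂ insertOnes β≡ enc

isCode⇒decodable : (m : ℕ) (u : Vec ℕ (suc m)) (c : Code) → IsCode (recordCount u) c → Decodable (suc m) u c
isCode⇒decodable zero (x ∷ []) single _ = refl , refl , refl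
isCode⇒decodable (suc m) u c isCode = byLastRecord (Vec.last (records 0 u)) refl
  where
  byCode : (j : ℕ) → recordCount (Vec.init u) ≡ suc j → recordCount u ≡ suc (suc j)
    → Vec.last (records 0 u) ≡ true →
    (c : Code) → IsCode (suc (suc j)) c → Decodable (suc (suc m)) u c
  byCode j count-init count lastRecord (appendFreshOne c′) isCode′ =
    decodable-appendFreshOne m u c′ lastRecord
      (isCode⇒decodable m (Vec.init u) c′ (IsCode-subst c′ (sym count-init) isCode′))
  byCode j count-init count lastRecord (appendOne c′) isCode′ =
    decodable-appendOne m u c′ lastRecord
      (isCode⇒decodable m (Vec.init u) c′ (IsCode-subst c′ (sym count-init) isCode′))
  byCode j count-init count lastRecord (insertOnes β c′) (length-β , anyFalse-β , isCode′) =
    decodable-insertOnes m u β c′ lastRecord length-β′ anyFalse-β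
      (λ r count-r → isCode⇒decodable m r c′ (IsCode-subst c′ (sym count-r) isCode′))
    where
    length-β′ : length β ≡ trues (Vec.init (records 0 u))
    length-β′ = trans length-β (ℕ.suc-injective (trans (sym count)
      (trans (recordCount-init-true u lastRecord) (cong suc (cong trues (records-init 0 u))))))
  byLastRecord : (b : Bool) → Vec.last (records 0 u) ≡ b → Decodable (suc (suc m)) u c
  byLastRecord false lastRecord = decodable-lastNotRecord m u c lastRecord
    (isCode⇒decodable m (Vec.init u) c (IsCode-subst c (recordCount-init-false u lastRecord) isCode))
  byLastRecord true lastRecord with recordCount-init-true′ u lastRecord
  ... | j , count-init , count = byCode j count-init count lastRecord c (IsCode-subst c count isCode)

-- Preference functions from codes

mergeOnes : List Bool → List ℕ → List ℕ
mergeOnes [] q = List.map suc q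
mergeOnes (true ∷ β) [] = []
mergeOnes (true ∷ β) (x ∷ q) = suc x ∷ mergeOnes β q
mergeOnes (false ∷ β) q = 1 ∷ mergeOnes β q

toPref : Code → List ℕ
toPref single = 1 ∷ []
toPref (appendFreshOne c) = List.map suc (toPref c) ∷ʳ 1
toPref (appendOne c) = toPref c ∷ʳ 1
toPref (insertOnes β c) = mergeOnes β (toPref c)

maxValue : Code → ℕ
maxValue single = 1
maxValue (appendFreshOne c) = suc (maxValue c)
maxValue (appendOne c) = maxValue c
maxValue (insertOnes β c) = suc (maxValue c)

IsPrefList : ℕ → List ℕ → Set
IsPrefList k p = ListAll.All (λ x → 1 ≤ x × x ≤ k) p × (∀ j → 1 ≤ j → j ≤ k → j ∈ p)

length-mergeOnes : (β : List Bool) (q : List ℕ) → length q ≡ suc (truesL β)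
  → length (mergeOnes β q) ≡ suc (length β)
length-mergeOnes [] q p = trans (List.length-map suc q) p
length-mergeOnes (true ∷ β) (x ∷ q) p = cong suc (length-mergeOnes β q (ℕ.suc-injective p))
length-mergeOnes (false ∷ β) q p = cong suc (length-mergeOnes β q p)

length-toPref : (b : ℕ) (c : Code) → IsCode b c → length (toPref c) ≡ b
length-toPref (suc zero) single w = refl
length-toPref (suc (suc b)) (appendFreshOne c) w =
  trans (List.length-++ (List.map suc (toPref c)))
    (trans (cong (_+ 1) (trans (List.length-map suc (toPref c)) (length-toPref (suc b) c w)))
      (ℕ.+-comm (suc b) 1))
length-toPref (suc (suc b)) (appendOne c) w =
  trans (List.length-++ (toPref c)) (trans (cong (_+ 1) (length-toPref (suc b) c w)) (ℕ.+-comm (suc b) 1))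
length-toPref (suc (suc b)) (insertOnes β c) (lβ , aβ , w) =
  trans (length-mergeOnes β (toPref c) (length-toPref (suc (truesL β)) c w)) (cong suc lβ)

anyFalse⇒truesL<length : (β : List Bool) → anyFalse β ≡ true → suc (truesL β) ≤ length β
anyFalse⇒truesL<length (false ∷ β) p = s≤s (cnt≤ β)
  where
  cnt≤ : (β : List Bool) → truesL β ≤ length β
  cnt≤ [] = z≤n
  cnt≤ (true ∷ β) = s≤s (cnt≤ β)
  cnt≤ (false ∷ β) = ℕ.m≤n⇒m≤1+n (cnt≤ β)
anyFalse⇒truesL<length (true ∷ β) p = s≤s (anyFalse⇒truesL<length β p)

maxValue≤ : (b : ℕ) (c : Code) → IsCode b c → maxValue c ≤ b
maxValue≤ (suc zero) single w = s≤s z≤n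
maxValue≤ (suc (suc b)) (appendFreshOne c) w = s≤s (maxValue≤ (suc b) c w)
maxValue≤ (suc (suc b)) (appendOne c) w = ℕ.m≤n⇒m≤1+n (maxValue≤ (suc b) c w)
maxValue≤ (suc (suc b)) (insertOnes β c) (lβ , aβ , w) =
  s≤s (ℕ.≤-trans (maxValue≤ (suc (truesL β)) c w)
    (subst (suc (truesL β) ≤_) lβ (anyFalse⇒truesL<length β aβ)))

All-mergeOnes : {P : ℕ → Set} (β : List Bool) (q : List ℕ) → P 1 → ListAll.All (λ x → P (suc x)) q
  → ListAll.All P (mergeOnes β q)
All-mergeOnes [] q p1 aq = ListAllₚ.map⁺ aq
All-mergeOnes (true ∷ β) [] p1 aq = []
All-mergeOnes (true ∷ β) (x ∷ q) p1 (px ∷ aq) = px ∷ All-mergeOnes β q p1 aq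
All-mergeOnes (false ∷ β) q p1 aq = p1 ∷ All-mergeOnes β q p1 aq

∈-mergeOnes : (β : List Bool) (q : List ℕ) (x : ℕ) → length q ≡ suc (truesL β) → x ∈ q → suc x ∈ mergeOnes β q
∈-mergeOnes [] q x l m = ∈.∈-map⁺ suc m
∈-mergeOnes (true ∷ β) (y ∷ q) x l (here refl) = here refl
∈-mergeOnes (true ∷ β) (y ∷ q) x l (there m) = there (∈-mergeOnes β q x (ℕ.suc-injective l) m)
∈-mergeOnes (false ∷ β) q x l m = there (∈-mergeOnes β q x l m)

1∈mergeOnes : (β : List Bool) (q : List ℕ) → length q ≡ suc (truesL β) → anyFalse β ≡ true → 1 ∈ mergeOnes β q
1∈mergeOnes (false ∷ β) q l p = here refl
1∈mergeOnes (true ∷ β) (y ∷ q) l p = there (1∈mergeOnes β q (ℕ.suc-injective l) p)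
1∈mergeOnes (true ∷ β) [] () p

maxValue-positive : (c : Code) → 1 ≤ maxValue c
maxValue-positive single = s≤s z≤n
maxValue-positive (appendFreshOne c) = s≤s z≤n
maxValue-positive (appendOne c) = maxValue-positive c
maxValue-positive (insertOnes β c) = s≤s z≤n

IsPrefList-toPref : (b : ℕ) (c : Code) → IsCode b c → IsPrefList (maxValue c) (toPref c)
IsPrefList-toPref (suc zero) single w = ((s≤s z≤n , s≤s z≤n) ∷ []) , cov
  where
  cov : ∀ j → 1 ≤ j → j ≤ 1 → j ∈ (1 ∷ [])
  cov (suc zero) _ _ = here refl
  cov (suc (suc j)) _ (s≤s ())
IsPrefList-toPref (suc (suc b)) (appendFreshOne c) w with IsPrefList-toPref (suc b) c w
... | (al , cv) = ListAllₚ.++⁺ (ListAllₚ.map⁺ (ListAll.map (λ (l , u) → ℕ.m≤n⇒m≤1+n l , s≤s u) al))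
  ((s≤s z≤n , s≤s z≤n) ∷ []) , cov
  where
  cov : ∀ j → 1 ≤ j → j ≤ suc (maxValue c) → j ∈ (List.map suc (toPref c) ∷ʳ 1)
  cov (suc zero) _ _ = ∈.∈-++⁺ʳ (List.map suc (toPref c)) (here refl)
  cov (suc (suc j)) _ (s≤s le) = ∈.∈-++⁺ˡ (∈.∈-map⁺ suc (cv (suc j) (s≤s z≤n) le))
IsPrefList-toPref (suc (suc b)) (appendOne c) w with IsPrefList-toPref (suc b) c w
... | (al , cv) = ListAllₚ.++⁺ al ((s≤s z≤n , kpos) ∷ []) , cov
  where
  kpos : 1 ≤ maxValue c
  kpos = maxValue-positive c
  cov : ∀ j → 1 ≤ j → j ≤ maxValue c → j ∈ (toPref c ∷ʳ 1)
  cov j l u = ∈.∈-++⁺ˡ (cv j l u)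
IsPrefList-toPref (suc (suc b)) (insertOnes β c) (lβ , aβ , w) with IsPrefList-toPref (suc (truesL β)) c w
... | (al , cv) = All-mergeOnes β (toPref c) (s≤s z≤n , s≤s z≤n)
  (ListAll.map (λ (l , u) → ℕ.m≤n⇒m≤1+n l , s≤s u) al) , cov
  where
  lq = length-toPref (suc (truesL β)) c w
  cov : ∀ j → 1 ≤ j → j ≤ suc (maxValue c) → j ∈ mergeOnes β (toPref c)
  cov (suc zero) _ _ = 1∈mergeOnes β (toPref c) lq aβ
  cov (suc (suc j)) _ (s≤s le) = ∈-mergeOnes β (toPref c) (suc j) lq (cv (suc j) (s≤s z≤n) le)

AllPositive : List ℕ → Set
AllPositive q = ListAll.All (λ x → 1 ≤ x) q

positive-toPref : (b : ℕ) (c : Code) → IsCode b c → AllPositive (toPref c)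
positive-toPref b c w = ListAll.map proj₁ (proj₁ (IsPrefList-toPref b c w))

1∉map-suc : (q : List ℕ) → AllPositive q → 1 ∈ List.map suc q → ⊥
1∉map-suc q pq m with ∈.∈-map⁻ suc m
... | .0 , xm , refl with ListAll.lookup pq xm
...   | ()

mergeOnes≢∷ʳ1 : (β : List Bool) (q : List ℕ) → length q ≡ suc (truesL β) → AllPositive q → (xs : List ℕ)
  → mergeOnes β q ≢ xs ∷ʳ 1
mergeOnes≢∷ʳ1 [] q l pq xs e = 1∉map-suc q pq (subst (1 ∈_) (sym e) (∈.∈-++⁺ʳ xs (here refl)))
mergeOnes≢∷ʳ1 (false ∷ β) q l pq [] e with length-mergeOnes β q l | List.∷-injectiveʳ e
... | lm | e2 rewrite e2 with lm
...   | ()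
mergeOnes≢∷ʳ1 (false ∷ β) q l pq (y ∷ xs) e = mergeOnes≢∷ʳ1 β q l pq xs (List.∷-injectiveʳ e)
mergeOnes≢∷ʳ1 (true ∷ β) [] () pq xs e
mergeOnes≢∷ʳ1 (true ∷ β) (x ∷ q) l (px ∷ pq) [] e with List.∷-injectiveˡ e
... | rest rewrite ℕ.suc-injective rest with px
...   | ()
mergeOnes≢∷ʳ1 (true ∷ β) (x ∷ q) l (px ∷ pq) (y ∷ xs) e =
  mergeOnes≢∷ʳ1 β q (ℕ.suc-injective l) pq xs (List.∷-injectiveʳ e)

mergeOnes-injective : (β β′ : List Bool) (q q′ : List ℕ) → length β ≡ length β′ → length q ≡ suc (truesL β)
  → length q′ ≡ suc (truesL β′) →
  AllPositive q → AllPositive q′ → mergeOnes β q ≡ mergeOnes β′ q′ → β ≡ β′ × q ≡ q′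
mergeOnes-injective [] [] q q′ lb l l′ p p′ e = refl , List.map-injective ℕ.suc-injective e
mergeOnes-injective [] (_ ∷ _) q q′ () l l′ p p′ e
mergeOnes-injective (_ ∷ _) [] q q′ () l l′ p p′ e
mergeOnes-injective (false ∷ β) (false ∷ β′) q q′ lb l l′ p p′ e with mergeOnes-injective β β′ q q′
  (ℕ.suc-injective lb) l l′ p p′ (List.∷-injectiveʳ e)
... | refl , refl = refl , refl
mergeOnes-injective (true ∷ β) (true ∷ β′) (x ∷ q) (x′ ∷ q′) lb l l′ (_ ∷ p) (_ ∷ p′) e with List.∷-injective
  e
... | rest , e2 with mergeOnes-injective β β′ q q′ (ℕ.suc-injective lb) (ℕ.suc-injective l) (ℕ.suc-injective l′)
  p p′ e2
...   | refl , refl rewrite ℕ.suc-injective rest = refl , refl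
mergeOnes-injective (true ∷ β) _ [] _ lb () l′ p p′ e
mergeOnes-injective _ (true ∷ β′) _ [] lb l () p p′ e
mergeOnes-injective (true ∷ β) (false ∷ β′) (x ∷ q) q′ lb l l′ (px ∷ p) p′ e with List.∷-injectiveˡ e
... | rest rewrite ℕ.suc-injective rest with px
...   | ()
mergeOnes-injective (false ∷ β) (true ∷ β′) q (x ∷ q′) lb l l′ p (px ∷ p′) e with List.∷-injectiveˡ e
... | rest rewrite ℕ.suc-injective (sym rest) with px
...   | ()

toPref-injective : (b : ℕ) (c c′ : Code) → IsCode b c → IsCode b c′ → toPref c ≡ toPref c′ → c ≡ c′
toPref-injective (suc zero) single single w w′ e = refl
toPref-injective (suc (suc b)) (appendFreshOne c) (appendFreshOne c′) w w′ e =
  cong appendFreshOne (toPref-injective (suc b) c c′ w w′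
    (List.map-injective ℕ.suc-injective
      (List.∷ʳ-injectiveˡ (List.map suc (toPref c)) (List.map suc (toPref c′)) e)))
toPref-injective (suc (suc b)) (appendOne c) (appendOne c′) w w′ e =
  cong appendOne (toPref-injective (suc b) c c′ w w′ (List.∷ʳ-injectiveˡ (toPref c) (toPref c′) e))
toPref-injective (suc (suc b)) (insertOnes β c) (insertOnes β′ c′) (lβ , _ , w) (lβ′ , _ , w′) e
  with mergeOnes-injective β β′ (toPref c) (toPref c′) (trans lβ (sym lβ′))
    (length-toPref (suc (truesL β)) c w) (length-toPref (suc (truesL β′)) c′ w′)
      (positive-toPref (suc (truesL β)) c w) (positive-toPref (suc (truesL β′)) c′ w′) e
... | refl , e2 = cong (insertOnes β) (toPref-injective (suc (truesL β)) c c′ w w′ e2)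
toPref-injective (suc (suc b)) (appendFreshOne c) (appendOne c′) w w′ e =
  ⊥-elim (1∉map-suc (toPref c) (positive-toPref (suc b) c w)
  (subst (1 ∈_) (sym (List.∷ʳ-injectiveˡ (List.map suc (toPref c)) (toPref c′) e))
    (proj₂ (IsPrefList-toPref (suc b) c′ w′) 1 (s≤s z≤n) (maxValue-positive c′))))
toPref-injective (suc (suc b)) (appendOne c) (appendFreshOne c′) w w′ e =
  ⊥-elim (1∉map-suc (toPref c′) (positive-toPref (suc b) c′ w′)
  (subst (1 ∈_) (List.∷ʳ-injectiveˡ (toPref c) (List.map suc (toPref c′)) e)
    (proj₂ (IsPrefList-toPref (suc b) c w) 1 (s≤s z≤n) (maxValue-positive c))))
toPref-injective (suc (suc b)) (appendFreshOne c) (insertOnes β c′) w (lβ , _ , w′) e =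
  ⊥-elim (mergeOnes≢∷ʳ1 β (toPref c′) (length-toPref (suc (truesL β)) c′ w′)
    (positive-toPref (suc (truesL β)) c′ w′) _ (sym e))
toPref-injective (suc (suc b)) (appendOne c) (insertOnes β c′) w (lβ , _ , w′) e =
  ⊥-elim (mergeOnes≢∷ʳ1 β (toPref c′) (length-toPref (suc (truesL β)) c′ w′)
    (positive-toPref (suc (truesL β)) c′ w′) _ (sym e))
toPref-injective (suc (suc b)) (insertOnes β c) (appendFreshOne c′) (lβ , _ , w) w′ e =
  ⊥-elim (mergeOnes≢∷ʳ1 β (toPref c) (length-toPref (suc (truesL β)) c w)
    (positive-toPref (suc (truesL β)) c w) _ e)
toPref-injective (suc (suc b)) (insertOnes β c) (appendOne c′) (lβ , _ , w) w′ e =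
  ⊥-elim (mergeOnes≢∷ʳ1 β (toPref c) (length-toPref (suc (truesL β)) c w)
    (positive-toPref (suc (truesL β)) c w) _ e)

aboveOne : ℕ → Bool
aboveOne zero = false
aboveOne (suc zero) = false
aboveOne (suc (suc _)) = true

dropOnes : List ℕ → List ℕ
dropOnes [] = []
dropOnes (x ∷ xs) = if aboveOne x then x ∷ dropOnes xs else dropOnes xs

length-∷ʳ : (ys : List ℕ) (y : ℕ) → length (ys ∷ʳ y) ≡ suc (length ys)
length-∷ʳ ys y = trans (List.length-++ ys) (ℕ.+-comm (length ys) 1)

∈-∷ʳ⁻ : {j l : ℕ} (xs : List ℕ) → j ∈ xs ∷ʳ l → j ∈ xs ⊎ j ≡ l
∈-∷ʳ⁻ {j} {l} xs m with ∈.∈-++⁻ xs m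
... | inj₁ a = inj₁ a
... | inj₂ (here e) = inj₂ e

mergeOnes-split : (xs : List ℕ) (l : ℕ) → AllPositive xs → 1 ≤ l
  → mergeOnes (List.map aboveOne xs) (List.map pred (dropOnes xs ∷ʳ l)) ≡ xs ∷ʳ l
mergeOnes-split [] (suc l) _ _ = refl
mergeOnes-split (suc zero ∷ xs) l (_ ∷ p) pl = cong (1 ∷_) (mergeOnes-split xs l p pl)
mergeOnes-split (suc (suc x) ∷ xs) l (_ ∷ p) pl = cong (suc (suc x) ∷_) (mergeOnes-split xs l p pl)

length-dropOnes : (xs : List ℕ) → length (dropOnes xs) ≡ truesL (List.map aboveOne xs)
length-dropOnes [] = refl
length-dropOnes (zero ∷ xs) = length-dropOnes xs
length-dropOnes (suc zero ∷ xs) = length-dropOnes xs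
length-dropOnes (suc (suc x) ∷ xs) = cong suc (length-dropOnes xs)

anyFalse-split : (xs : List ℕ) → 1 ∈ xs → anyFalse (List.map aboveOne xs) ≡ true
anyFalse-split (x ∷ xs) (here refl) = refl
anyFalse-split (zero ∷ xs) (there m) = refl
anyFalse-split (suc zero ∷ xs) (there m) = refl
anyFalse-split (suc (suc x) ∷ xs) (there m) = anyFalse-split xs m

∈-dropOnes : (xs : List ℕ) (j : ℕ) → j ∈ xs → 2 ≤ j → j ∈ dropOnes xs
∈-dropOnes (zero ∷ xs) j (here refl) ()
∈-dropOnes (suc zero ∷ xs) j (here refl) (s≤s ())
∈-dropOnes (suc (suc x) ∷ xs) j (here refl) le = here refl
∈-dropOnes (zero ∷ xs) j (there m) le = ∈-dropOnes xs j m le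
∈-dropOnes (suc zero ∷ xs) j (there m) le = ∈-dropOnes xs j m le
∈-dropOnes (suc (suc x) ∷ xs) j (there m) le = there (∈-dropOnes xs j m le)

All-dropOnes : (xs : List ℕ) {P : ℕ → Set} → ListAll.All P xs → ListAll.All (λ x → 2 ≤ x × P x) (dropOnes xs)
All-dropOnes [] [] = []
All-dropOnes (zero ∷ xs) (_ ∷ a) = All-dropOnes xs a
All-dropOnes (suc zero ∷ xs) (_ ∷ a) = All-dropOnes xs a
All-dropOnes (suc (suc x) ∷ xs) (px ∷ a) = (s≤s (s≤s z≤n) , px) ∷ All-dropOnes xs a

1∉⇒≥2 : (xs : List ℕ) → ¬ (1 ∈ xs) → ListAll.All (λ x → 1 ≤ x) xs → ListAll.All (λ x → 2 ≤ x) xs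
1∉⇒≥2 [] n a = []
1∉⇒≥2 (suc zero ∷ xs) n (_ ∷ a) = ⊥-elim (n (here refl))
1∉⇒≥2 (suc (suc x) ∷ xs) n (_ ∷ a) = s≤s (s≤s z≤n) ∷ 1∉⇒≥2 xs (λ m → n (there m)) a

map-suc-pred : (xs : List ℕ) → ListAll.All (λ x → 1 ≤ x) xs → List.map suc (List.map pred xs) ≡ xs
map-suc-pred [] [] = refl
map-suc-pred (suc x ∷ xs) (_ ∷ a) = cong (suc x ∷_) (map-suc-pred xs a)
pred-bounds : {k x : ℕ} → 2 ≤ x → x ≤ k → 1 ≤ pred x × pred x ≤ pred k
pred-bounds (s≤s 1≤x) x≤k = 1≤x , ℕ.pred-mono-≤ x≤k

≢1⇒≥2 : (l : ℕ) → 1 ≤ l → l ≢ 1 → 2 ≤ l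
≢1⇒≥2 (suc zero) _ l≢1 = ⊥-elim (l≢1 refl)
≢1⇒≥2 (suc (suc l)) _ _ = s≤s (s≤s z≤n)

≤pred⇒suc≤ : {j k : ℕ} → 1 ≤ k → j ≤ pred k → suc j ≤ k
≤pred⇒suc≤ {k = suc k} _ j≤ = s≤s j≤

IsPrefList-dropLastOne : {k : ℕ} (xs : List ℕ) → IsPrefList k (xs ∷ʳ 1) → 1 ∈ xs → IsPrefList k xs
IsPrefList-dropLastOne xs (bounds , covers) 1∈xs = ListAllₚ.++⁻ˡ xs bounds , cover
  where
  cover : ∀ j → 1 ≤ j → j ≤ _ → j ∈ xs
  cover j 1≤j j≤k with ∈-∷ʳ⁻ xs (covers j 1≤j j≤k)
  ... | inj₁ j∈xs = j∈xs
  ... | inj₂ refl = 1∈xs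

IsPrefList-lowerFreshOne : {k : ℕ} (xs : List ℕ) → IsPrefList k (xs ∷ʳ 1) → ¬ (1 ∈ xs) →
  IsPrefList (pred k) (List.map pred xs)
IsPrefList-lowerFreshOne {k} xs (bounds , covers) 1∉xs =
  ListAllₚ.map⁺ (ListAll.zipWith (λ (2≤x , (_ , x≤k)) → pred-bounds 2≤x x≤k)
    (above , ListAllₚ.++⁻ˡ xs bounds)) , cover
  where
  above : ListAll.All (λ x → 2 ≤ x) xs
  above = 1∉⇒≥2 xs 1∉xs (ListAll.map proj₁ (ListAllₚ.++⁻ˡ xs bounds))
  1≤k : 1 ≤ k
  1≤k = proj₂ (ListAll.head (ListAllₚ.++⁻ʳ xs bounds))
  cover : ∀ j → 1 ≤ j → j ≤ pred k → j ∈ List.map pred xs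
  cover (suc j) _ j≤ with ∈-∷ʳ⁻ xs (covers (suc (suc j)) (s≤s z≤n) (≤pred⇒suc≤ 1≤k j≤))
  ... | inj₁ j+2∈xs = ∈.∈-map⁺ pred j+2∈xs

IsPrefList-lowerDropOnes : {k l : ℕ} (xs : List ℕ) → IsPrefList k (xs ∷ʳ l) → l ≢ 1 →
  1 ∈ xs × IsPrefList (pred k) (List.map pred (dropOnes xs ∷ʳ l))
IsPrefList-lowerDropOnes {k} {l} xs (bounds , covers) l≢1 = 1∈xs , ListAllₚ.map⁺ lowered , cover
  where
  bound-l : 1 ≤ l × l ≤ k
  bound-l = ListAll.head (ListAllₚ.++⁻ʳ xs bounds)
  2≤l : 2 ≤ l
  2≤l = ≢1⇒≥2 l (proj₁ bound-l) l≢1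
  1≤k : 1 ≤ k
  1≤k = ℕ.≤-trans (proj₁ bound-l) (proj₂ bound-l)
  1∈xs : 1 ∈ xs
  1∈xs with ∈-∷ʳ⁻ xs (covers 1 (s≤s z≤n) 1≤k)
  ... | inj₁ 1∈ = 1∈
  ... | inj₂ 1≡l = ⊥-elim (l≢1 (sym 1≡l))
  lowered : ListAll.All (λ x → 1 ≤ pred x × pred x ≤ pred k) (dropOnes xs ∷ʳ l)
  lowered = ListAllₚ.++⁺
    (ListAll.map (λ (2≤x , (_ , x≤k)) → pred-bounds 2≤x x≤k) (All-dropOnes xs (ListAllₚ.++⁻ˡ xs bounds)))
    (pred-bounds 2≤l (proj₂ bound-l) ∷ [])
  cover : ∀ j → 1 ≤ j → j ≤ pred k → j ∈ List.map pred (dropOnes xs ∷ʳ l)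
  cover (suc j) _ j≤ with ∈-∷ʳ⁻ xs (covers (suc (suc j)) (s≤s z≤n) (≤pred⇒suc≤ 1≤k j≤))
  ... | inj₁ j+2∈xs = ∈.∈-map⁺ pred (∈.∈-++⁺ˡ (∈-dropOnes xs (suc (suc j)) j+2∈xs (s≤s (s≤s z≤n))))
  ... | inj₂ refl = ∈.∈-map⁺ pred (∈.∈-++⁺ʳ (dropOnes xs) (here refl))

Coded : List ℕ → ℕ → Set
Coded xs l = ∃ λ c → IsCode (suc (length xs)) c × toPref c ≡ xs ∷ʳ l

CodedBelow : ℕ → Set
CodedBelow n = ∀ xs l k → length xs < n → IsPrefList k (xs ∷ʳ l) → Coded xs l

coded-lastOne : (xs : List ℕ) (k : ℕ) → IsPrefList k (xs ∷ʳ 1) → CodedBelow (length xs) → Coded xs 1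
coded-lastOne xs k pref below with List.initLast xs
... | [] = single , tt , refl
... | ys List.∷ʳ′ y with 1 ∈? (ys ∷ʳ y)
...   | yes 1∈ with below ys y k shorter (IsPrefList-dropLastOne (ys ∷ʳ y) pref 1∈)
  where
  shorter : length ys < length (ys ∷ʳ y)
  shorter = subst (length ys <_) (sym (length-∷ʳ ys y)) ℕ.≤-refl
...     | c , isCode , c≡ =
  appendOne c , IsCode-subst (appendOne c) (cong suc (sym (length-∷ʳ ys y))) isCode , cong (_∷ʳ 1) c≡
coded-lastOne xs k pref below | ys List.∷ʳ′ y | no 1∉
  with below (List.map pred ys) (pred y) (pred k) shorter lowered
  where
  shorter : length (List.map pred ys) < length (ys ∷ʳ y)
  shorter = subst₂ _<_ (sym (List.length-map pred ys)) (sym (length-∷ʳ ys y)) ℕ.≤-refl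
  lowered : IsPrefList (pred k) (List.map pred ys ∷ʳ pred y)
  lowered = subst (IsPrefList (pred k)) (List.map-++ pred ys (y ∷ []))
    (IsPrefList-lowerFreshOne (ys ∷ʳ y) pref 1∉)
... | c , isCode , c≡ = appendFreshOne c , isCode′ , cong (_∷ʳ 1) restored
  where
  isCode′ : IsCode (suc (length (ys ∷ʳ y))) (appendFreshOne c)
  isCode′ = IsCode-subst (appendFreshOne c)
    (cong suc (sym (trans (length-∷ʳ ys y) (cong suc (sym (List.length-map pred ys)))))) isCode
  positive : AllPositive (ys ∷ʳ y)
  positive = ListAll.map proj₁ (ListAllₚ.++⁻ˡ (ys ∷ʳ y) (proj₁ pref))
  restored : List.map suc (toPref c) ≡ ys ∷ʳ y
  restored = trans (cong (List.map suc) (trans c≡ (sym (List.map-++ pred ys (y ∷ [])))))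
    (map-suc-pred (ys ∷ʳ y) positive)

coded-insertOnes : (xs : List ℕ) (l k : ℕ) → IsPrefList k (xs ∷ʳ l) → l ≢ 1 → CodedBelow (length xs)
  → Coded xs l
coded-insertOnes xs l k pref l≢1 below with IsPrefList-lowerDropOnes xs pref l≢1
... | 1∈xs , lowered with below (List.map pred (dropOnes xs)) (pred l) (pred k) shorter lowered′
  where
  β = List.map aboveOne xs
  length-rest : length (List.map pred (dropOnes xs)) ≡ truesL β
  length-rest = trans (List.length-map pred (dropOnes xs)) (length-dropOnes xs)
  shorter : length (List.map pred (dropOnes xs)) < length xs
  shorter = subst₂ _<_ (sym length-rest) (List.length-map aboveOne xs)
    (anyFalse⇒truesL<length β (anyFalse-split xs 1∈xs))
  lowered′ : IsPrefList (pred k) (List.map pred (dropOnes xs) ∷ʳ pred l)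
  lowered′ = subst (IsPrefList (pred k)) (List.map-++ pred (dropOnes xs) (l ∷ [])) lowered
... | c , isCode , c≡ = insertOnes β c , isCode′ , merged
  where
  β = List.map aboveOne xs
  isCode′ : IsCode (suc (length xs)) (insertOnes β c)
  isCode′ = IsCode-insertOnes (cong suc (sym (List.length-map aboveOne xs))) (anyFalse-split xs 1∈xs)
    (IsCode-subst c (cong suc (trans (List.length-map pred (dropOnes xs)) (length-dropOnes xs))) isCode)
  positive : AllPositive xs
  positive = ListAll.map proj₁ (ListAllₚ.++⁻ˡ xs (proj₁ pref))
  merged : mergeOnes β (toPref c) ≡ xs ∷ʳ l
  merged = trans (cong (mergeOnes β) (trans c≡ (sym (List.map-++ pred (dropOnes xs) (l ∷ [])))))
    (mergeOnes-split xs l positive (proj₁ (ListAll.head (ListAllₚ.++⁻ʳ xs (proj₁ pref)))))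

codedBelow : (n : ℕ) → CodedBelow n
codedBelow (suc n) xs l k (s≤s len) pref with l ℕ.≟ 1
... | yes refl = coded-lastOne xs k pref
  (λ xs′ l′ k′ shorter → codedBelow n xs′ l′ k′ (ℕ.<-≤-trans shorter len))
... | no l≢1 = coded-insertOnes xs l k pref l≢1
  (λ xs′ l′ k′ shorter → codedBelow n xs′ l′ k′ (ℕ.<-≤-trans shorter len))

allRows : (k : ℕ) → List (Vec Bool k)
allRows zero = [] ∷ []
allRows (suc k) = List.map (true ∷_) (allRows k) ++ List.map (false ∷_) (allRows k)

∈-allRows : {k : ℕ} (v : Vec Bool k) → v ∈ allRows k
∈-allRows [] = here refl
∈-allRows {suc k} (true ∷ v) = ∈.∈-++⁺ˡ (∈.∈-map⁺ (true ∷_) (∈-allRows v))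
∈-allRows {suc k} (false ∷ v) = ∈.∈-++⁺ʳ (List.map (true ∷_) (allRows k)) (∈.∈-map⁺ (false ∷_) (∈-allRows v))

allRows-unique : (k : ℕ) → Unique (allRows k)
allRows-unique zero = [] ∷ []
allRows-unique (suc k) =
  Unique.++⁺ (Unique.map⁺ ∷-injectiveʳ (allRows-unique k)) (Unique.map⁺ ∷-injectiveʳ (allRows-unique k))
    disjoint
  where
  ∷-injectiveʳ : {b c : Bool} {v w : Vec Bool k} → b ∷ v ≡ c ∷ w → v ≡ w
  ∷-injectiveʳ refl = refl
  disjoint : ∀ {v} → v ∈ List.map (true ∷_) (allRows k) × v ∈ List.map (false ∷_) (allRows k) → ⊥
  disjoint (∈true , ∈false) with ∈.∈-map⁻ (true ∷_) ∈true | ∈.∈-map⁻ (false ∷_) ∈false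
  ... | _ , _ , refl | _ , _ , ()

allDiagrams : (m : ℕ) → List (Diagram m)
allDiagrams zero = tt ∷ []
allDiagrams (suc m) = List.cartesianProduct (allRows (suc m)) (allDiagrams m)

∈-allDiagrams : (m : ℕ) (D : Diagram m) → D ∈ allDiagrams m
∈-allDiagrams zero tt = here refl
∈-allDiagrams (suc m) (v , D) = ∈.∈-cartesianProduct⁺ (∈-allRows v) (∈-allDiagrams m D)

allDiagrams-unique : (m : ℕ) → Unique (allDiagrams m)
allDiagrams-unique zero = [] ∷ []
allDiagrams-unique (suc m) = Unique.cartesianProduct⁺ (allRows-unique (suc m)) (allDiagrams-unique m)

HasCount-filter : {A : Set} {P : A → Set} (P? : Decidable P) (xs : List A) → Unique xs → (∀ x → x ∈ xs) →
  HasCount P (length (List.filter P? xs))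
HasCount-filter P? xs unique complete =
  List.filter P? xs , Unique.filter⁺ P? unique ,
    (λ x → (∈.∈-filter⁺ P? (complete x)) , (λ x∈ → proj₂ (∈.∈-filter⁻ P? {xs = xs} x∈))) , refl

Unique-map-injectiveOn : {A B : Set} (f : A → B) (xs : List A) → Unique xs →
  (∀ {x y} → x ∈ xs → y ∈ xs → f x ≡ f y → x ≡ y) → Unique (List.map f xs)
Unique-map-injectiveOn f [] _ _ = []
Unique-map-injectiveOn f (x ∷ xs) (x∉ ∷ unique) injective =
  fresh (ListAll.tabulate (λ y∈ fx≡fy → ListAll.lookup x∉ y∈ (injective (here refl) (there y∈) fx≡fy)))
  ∷ Unique-map-injectiveOn f xs unique (λ x∈ y∈ → injective (there x∈) (there y∈))
  where
  fresh : {ys : List _} → ListAll.All (λ y → f x ≢ f y) ys → ListAll.All (f x ≢_) (List.map f ys)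
  fresh [] = []
  fresh (p ∷ ps) = p ∷ fresh ps

HasCount-bijection : {A B : Set} {P : A → Set} {R : B → Set} {a : ℕ} → SubsetBijection P R → HasCount P a
  → HasCount R a
HasCount-bijection {P = P} {R} (f , preserves , injective , surjective) (xs , unique , members , length≡) =
  List.map f xs , Unique-map-injectiveOn f xs unique (λ x∈ y∈ → injective _ _ (from x∈) (from y∈))
  , (λ y → to′ y , from′ y) , trans (List.length-map f xs) length≡
  where
  from : ∀ {x} → x ∈ xs → P x
  from {x} = proj₂ (members x)
  to′ : ∀ y → R y → y ∈ List.map f xs
  to′ y Ry with surjective y Ry
  ... | x , Px , refl = ∈.∈-map⁺ f (proj₁ (members x) Px)
  from′ : ∀ y → y ∈ List.map f xs → R y
  from′ y y∈ with ∈.∈-map⁻ f y∈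
  ... | x , x∈ , refl = preserves x (from x∈)

HasCount-involution : {A : Set} {P R : A → Set} {a : ℕ} (ι : A → A) → (∀ x → ι (ι x) ≡ x) →
  (∀ x → P x → ¬ P (ι x)) → (∀ x → R x → P x ⊎ P (ι x)) → (∀ x → P x → R x) → (∀ x → P x → R (ι x)) →
  HasCount P a → HasCount R (a + a)
HasCount-involution {P = P} {R} ι involutive exclusive cover P⇒R P⇒Rι (xs , unique , members , length≡) =
  xs ++ List.map ι xs
  , Unique.++⁺ unique (Unique.map⁺ ι-injective unique) disjoint
  , (λ x → to x , from x)
  , trans (List.length-++ xs) (cong₂ _+_ length≡ (trans (List.length-map ι xs) length≡))
  where
  ι-injective : ∀ {x y} → ι x ≡ ι y → x ≡ y
  ι-injective {x} {y} eq = trans (sym (involutive x)) (trans (cong ι eq) (involutive y))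
  disjoint : ∀ {x} → x ∈ xs × x ∈ List.map ι xs → ⊥
  disjoint (x∈ , x∈ι) with ∈.∈-map⁻ ι x∈ι
  ... | y , y∈ , refl = exclusive y (proj₂ (members y) y∈) (proj₂ (members (ι y)) x∈)
  to : ∀ x → R x → x ∈ xs ++ List.map ι xs
  to x Rx with cover x Rx
  ... | inj₁ Px = ∈.∈-++⁺ˡ (proj₁ (members x) Px)
  ... | inj₂ Pιx = ∈.∈-++⁺ʳ xs
    (subst (_∈ List.map ι xs) (involutive x) (∈.∈-map⁺ ι (proj₁ (members (ι x)) Pιx)))
  from : ∀ x → x ∈ xs ++ List.map ι xs → R x
  from x x∈ with ∈.∈-++⁻ xs x∈
  ... | inj₁ x∈xs = P⇒R x (proj₂ (members x) x∈xs)
  ... | inj₂ x∈ι with ∈.∈-map⁻ ι x∈ι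
  ...   | y , y∈ , refl = P⇒Rι y (proj₂ (members y) y∈)

-- Pads with zeros (or truncates); only applied to lists of length n.
listToVec : (n : ℕ) → List ℕ → Vec ℕ n
listToVec zero xs = []
listToVec (suc n) [] = 0 ∷ listToVec n []
listToVec (suc n) (x ∷ xs) = x ∷ listToVec n xs

toList-listToVec : (n : ℕ) (xs : List ℕ) → length xs ≡ n → toList (listToVec n xs) ≡ xs
toList-listToVec zero [] _ = refl
toList-listToVec (suc n) (x ∷ xs) len = cong (x ∷_) (toList-listToVec n xs (ℕ.suc-injective len))

listToVec-toList : {n : ℕ} (v : Vec ℕ n) → listToVec n (toList v) ≡ v
listToVec-toList [] = refl
listToVec-toList (x ∷ v) = cong (x ∷_) (listToVec-toList v)

All-toList⇒lookup : {n : ℕ} {P : ℕ → Set} (v : Vec ℕ n) → ListAll.All P (toList v) → (i : Fin n)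
  → P (lookup v i)
All-toList⇒lookup (x ∷ v) (p ∷ ps) fzero = p
All-toList⇒lookup (x ∷ v) (p ∷ ps) (fsuc i) = All-toList⇒lookup v ps i

lookup⇒All-toList : {n : ℕ} {P : ℕ → Set} (v : Vec ℕ n) → ((i : Fin n) → P (lookup v i))
  → ListAll.All P (toList v)
lookup⇒All-toList [] _ = []
lookup⇒All-toList (x ∷ v) p = p fzero ∷ lookup⇒All-toList v (λ i → p (fsuc i))

∈-toList⇒lookup : {n : ℕ} (v : Vec ℕ n) {j : ℕ} → j ∈ toList v → ∃ λ i → lookup v i ≡ j
∈-toList⇒lookup (x ∷ v) (here refl) = fzero , refl
∈-toList⇒lookup (x ∷ v) (there j∈) with ∈-toList⇒lookup v j∈
... | i , eq = fsuc i , eq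

lookup-∈-toList : {n : ℕ} (v : Vec ℕ n) (i : Fin n) → lookup v i ∈ toList v
lookup-∈-toList (x ∷ v) fzero = here refl
lookup-∈-toList (x ∷ v) (fsuc i) = there (lookup-∈-toList v i)

IsPrefList⇒IsPref : {n k : ℕ} (v : Vec ℕ n) → k ≤ n → IsPrefList k (toList v) → IsPref n v
IsPrefList⇒IsPref {k = k} v k≤n (bounds , covers) =
  k , k≤n , All-toList⇒lookup v bounds , (λ j 1≤j j≤k → ∈-toList⇒lookup v (covers j 1≤j j≤k))

IsPref⇒IsPrefList : {n : ℕ} (v : Vec ℕ n) → IsPref n v → ∃ λ k → IsPrefList k (toList v)
IsPref⇒IsPrefList v (k , _ , bounds , covers) =
  k , lookup⇒All-toList v bounds , λ j 1≤j j≤k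
    → let i , eq = covers j 1≤j j≤k in subst (_∈ toList v) eq (lookup-∈-toList v i)

recordCount-upFrom : (t a m : ℕ) → t ≤ a → trues (records t (upFrom a m)) ≡ m
recordCount-upFrom t a zero t≤a = refl
recordCount-upFrom t a (suc m) t≤a rewrite ≤⇒≤ᵇ-true t≤a =
  cong suc (recordCount-upFrom (suc a) (suc a) m ℕ.≤-refl)

toPrefVec : (n : ℕ) → Diagram n → Vec ℕ n
toPrefVec n D = listToVec n (toPref (encode n (upFrom 0 n) D))

InB⇒encodable : (m : ℕ) (D : Diagram (suc m)) → InB (suc m) D →
  IsCode (suc m) (encode (suc m) (upFrom 0 (suc m)) D) × decode (suc m) (upFrom 0 (suc m))
    (encode (suc m) (upFrom 0 (suc m)) D) ≡ D
InB⇒encodable m D (γ , bot) with valid⇒encodable m (upFrom 0 (suc m)) D (IsΓ⇒valid (suc m) D γ) bot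
... | isCode , decodes = IsCode-subst _ (recordCount-upFrom 0 0 (suc m) z≤n) isCode , decodes

toList-toPrefVec : (m : ℕ) (D : Diagram (suc m)) → InB (suc m) D →
  toList (toPrefVec (suc m) D) ≡ toPref (encode (suc m) (upFrom 0 (suc m)) D)
toList-toPrefVec m D inB =
  toList-listToVec (suc m) _ (length-toPref (suc m) _ (proj₁ (InB⇒encodable m D inB)))

toPrefVec-IsPref : (m : ℕ) (D : Diagram (suc m)) → InB (suc m) D → IsPref (suc m) (toPrefVec (suc m) D)
toPrefVec-IsPref m D inB =
  IsPrefList⇒IsPref (toPrefVec (suc m) D) (maxValue≤ (suc m) c isCode)
    (subst (IsPrefList (maxValue c)) (sym (toList-toPrefVec m D inB)) (IsPrefList-toPref (suc m) c isCode))
  where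
  c = encode (suc m) (upFrom 0 (suc m)) D
  isCode = proj₁ (InB⇒encodable m D inB)

toPrefVec-injective : (m : ℕ) (D D′ : Diagram (suc m)) → InB (suc m) D → InB (suc m) D′ →
  toPrefVec (suc m) D ≡ toPrefVec (suc m) D′ → D ≡ D′
toPrefVec-injective m D D′ inB inB′ eq with InB⇒encodable m D inB | InB⇒encodable m D′ inB′
... | isCode , decodes | isCode′ , decodes′ = begin
  D                                     ≡⟨ sym decodes ⟩
  decode (suc m) u (encode (suc m) u D)  ≡⟨ cong (decode (suc m) u) same-code ⟩
  decode (suc m) u (encode (suc m) u D′) ≡⟨ decodes′ ⟩
  D′                                    ∎
  where
  open ≡-Reasoning
  u = upFrom 0 (suc m)
  same-code : encode (suc m) u D ≡ encode (suc m) u D′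
  same-code = toPref-injective (suc m) _ _ isCode isCode′
    (trans (sym (toList-toPrefVec m D inB)) (trans (cong toList eq) (toList-toPrefVec m D′ inB′)))

toPrefVec-surjective : (m : ℕ) (v : Vec ℕ (suc m)) → IsPref (suc m) v → ∃ λ D
  → InB (suc m) D × toPrefVec (suc m) D ≡ v
toPrefVec-surjective m v isPref with IsPref⇒IsPrefList v isPref
... | k , pref = fromPrefList (toList v) refl pref
  where
  u = upFrom 0 (suc m)
  fromPrefList : (p : List ℕ) → toList v ≡ p → IsPrefList k p → ∃ λ D
    → InB (suc m) D × toPrefVec (suc m) D ≡ v
  fromPrefList p v≡p pref′ with List.initLast p
  ... | [] = ⊥-elim (ℕ.1+n≢0 (trans (sym (length-toList v)) (cong length v≡p)))
  ... | xs List.∷ʳ′ l with codedBelow (suc (length xs)) xs l k ℕ.≤-refl pref′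
  ...   | c , isCode , c≡ with isCode⇒decodable m u c (IsCode-subst c count≡ isCode)
    where
    count≡ : suc (length xs) ≡ recordCount u
    count≡ = trans (trans (sym (length-∷ʳ xs l)) (trans (cong length (sym v≡p)) (length-toList v)))
                   (sym (recordCount-upFrom 0 0 (suc m) z≤n))
  ...     | ok , bot , encodes = decode (suc m) u c , (valid⇒IsΓ (suc m) _ ok , bot) , prefVec≡
    where
    prefVec≡ : toPrefVec (suc m) (decode (suc m) u c) ≡ v
    prefVec≡ = begin
      listToVec (suc m) (toPref (encode (suc m) u (decode (suc m) u c)))
        ≡⟨ cong (λ c′ → listToVec (suc m) (toPref c′)) encodes ⟩
      listToVec (suc m) (toPref c)
        ≡⟨ cong (listToVec (suc m)) (trans c≡ (sym v≡p)) ⟩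
      listToVec (suc m) (toList v)                                       ≡⟨ listToVec-toList v ⟩
      v                                                                  ∎
      where open ≡-Reasoning

InB↔IsPref : (n : ℕ) → 1 ≤ n → SubsetBijection (InB n) (IsPref n)
InB↔IsPref (suc m) _ = toPrefVec (suc m) , toPrefVec-IsPref m , toPrefVec-injective m , toPrefVec-surjective m

flipBottom : (m : ℕ) → Diagram m → Diagram m
flipBottom zero tt = tt
flipBottom (suc zero) ((b ∷ []) , tt) = (not b ∷ []) , tt
flipBottom (suc (suc m)) (v , D) = v , flipBottom (suc m) D

flipBottom-involutive : (m : ℕ) (D : Diagram m) → flipBottom m (flipBottom m D) ≡ D
flipBottom-involutive zero tt = refl
flipBottom-involutive (suc zero) ((true ∷ []) , tt) = refl
flipBottom-involutive (suc zero) ((false ∷ []) , tt) = refl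
flipBottom-involutive (suc (suc m)) (v , D) = cong (v ,_) (flipBottom-involutive (suc m) D)

bottom-flipBottom : (m : ℕ) (D : Diagram (suc m))
  → bottom (suc m) (flipBottom (suc m) D) ≡ not (bottom (suc m) D)
bottom-flipBottom zero ((b ∷ []) , tt) = refl
bottom-flipBottom (suc m) (v , D) = bottom-flipBottom m D

-- The last row is the single box s_n acting on a positive entry, an ascent whatever its content.
valid-flipBottom : (m : ℕ) (u : Vec ℕ m) (D : Diagram m) → valid m u (flipBottom m D) ≡ valid m u D
validAfter-flipBottom : (m : ℕ) (R : RowOutcome (suc m)) (D : Diagram (suc m)) →
  (∀ t → valid (suc m) t (flipBottom (suc m) D) ≡ valid (suc m) t D) →
  validAfter (suc m) R (flipBottom (suc m) D) ≡ validAfter (suc m) R D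
valid-flipBottom zero [] tt = refl
valid-flipBottom (suc zero) (x ∷ []) ((true ∷ []) , tt) = refl
valid-flipBottom (suc zero) (x ∷ []) ((false ∷ []) , tt) = refl
valid-flipBottom (suc (suc m)) u (v , D) =
  validAfter-flipBottom m (rowOutcome u v) D (λ t → valid-flipBottom (suc m) t D)
validAfter-flipBottom m blocked D _ = refl
validAfter-flipBottom m (negHead t) D rest = rest t
validAfter-flipBottom m (posHead c t) D rest = rest t

IsΓ-flipBottom : (n : ℕ) (D : Diagram n) → IsΓ n D → IsΓ n (flipBottom n D)
IsΓ-flipBottom n D γ =
  valid⇒IsΓ n (flipBottom n D) (trans (valid-flipBottom n (upFrom 0 n) D) (IsΓ⇒valid n D γ))

InB? : (n : ℕ) → Decidable (InB n)
InB? n D = decide (valid n (upFrom 0 n) D) (bottom n D) refl refl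
  where
  false≢true : false ≢ true
  false≢true ()
  decide : (a b : Bool) → valid n (upFrom 0 n) D ≡ a → bottom n D ≡ b → Dec (InB n D)
  decide true true ok bot = yes (valid⇒IsΓ n D ok , bot)
  decide true false ok bot = no λ (_ , bot′) → false≢true (trans (sym bot) bot′)
  decide false _ ok bot = no λ (γ , _) → false≢true (trans (sym ok) (IsΓ⇒valid n D γ))

HasCount-IsΓ : (m : ℕ) {a : ℕ} → HasCount (InB (suc m)) a → HasCount (IsΓ (suc m)) (a + a)
HasCount-IsΓ m = HasCount-involution (flipBottom (suc m)) (flipBottom-involutive (suc m)) exclusive cover
  (λ _ → proj₁) (λ D (γ , _) → IsΓ-flipBottom (suc m) D γ)
  where
  exclusive : ∀ D → InB (suc m) D → ¬ InB (suc m) (flipBottom (suc m) D)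
  exclusive D (_ , bot) (_ , bot′) with trans (sym bot′) (trans (bottom-flipBottom m D) (cong not bot))
  ... | ()
  cover : ∀ D → IsΓ (suc m) D → InB (suc m) D ⊎ InB (suc m) (flipBottom (suc m) D)
  cover D γ = byBottom (bottom (suc m) D) refl
    where
    byBottom : (b : Bool) → bottom (suc m) D ≡ b → InB (suc m) D ⊎ InB (suc m) (flipBottom (suc m) D)
    byBottom true bot = inj₁ (γ , bot)
    byBottom false bot = inj₂ (IsΓ-flipBottom (suc m) D γ , trans (bottom-flipBottom m D) (cong not bot))

mainTheorem16 : (n : ℕ) → 1 ≤ n →
    SubsetBijection (InB n) (IsPref n)
    × (∃₂ λ a b → HasCount (IsΓ n) a × HasCount (IsPref n) b × a ≡ 2 * b)
mainTheorem16 (suc m) 1≤n =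
  bijection , b + b , b , HasCount-IsΓ m countB , HasCount-bijection bijection countB , b+b≡2*b
  where
  bijection = InB↔IsPref (suc m) 1≤n
  b = length (List.filter (InB? (suc m)) (allDiagrams (suc m)))
  countB : HasCount (InB (suc m)) b
  countB = HasCount-filter (InB? (suc m)) (allDiagrams (suc m))
    (allDiagrams-unique (suc m)) (∈-allDiagrams (suc m))
  b+b≡2*b : b + b ≡ 2 * b
  b+b≡2*b = cong (_+_ b) (sym (ℕ.+-identityʳ b))
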